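{- Let $\mathbf{R}$ be a commutative ring containing $\mathbb{Q}$ and let $\mathcal{TR}$ be the triple Riordan group (defined in the context). Let $\mathcal{D}=\{(g,x,x,x): g\in\mathbf{R}[[x^3]],\ g_0=1\}$ and $\mathcal{A}=\{(1,f_1,f_2,f_3): f_i\in x\mathbf{R}[[x^3]],\ (f_i)_1=1\}$. Then every element satisfies $(g,x,x,x)\cdot(1,f_1,f_2,f_3)=(g,f_1,f_2,f_3)$, and $\mathcal{TR}$ is the semi-direct product of the subgroups $\mathcal{D}$ and $\mathcal{A}$.
   Context: $\mathcal{TR}$ is the set of $4$-tuples $(g,f_1,f_2,f_3)$ with $g\in\mathbf{R}[[x^3]]$, $g_0=1$, $f_i\in x\mathbf{R}[[x^3]]$, $(f_i)_1=1$ ($g_0$ the constant coefficient, $(f_i)_1$ the coefficient of $x$), with product $(g,f_1,f_2,f_3)\cdot(G,F_1,F_2,F_3)=\left(gG(h),\frac{f_1}{h}F_1(h),\frac{f_2}{h}F_2(h),\frac{f_3}{h}F_3(h)\right)$ where $h=(f_1f_2f_3)^{1/3}$ is the series $x+\cdots$ whose cube is $f_1f_2f_3$. It is a group with identity $(1,x,x,x)$. -}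

module Defs where

open import Level using (_⊔_)
open import Data.Nat as ℕ using (ℕ; zero; suc; _∸_)
open import Data.Nat.DivMod using (_%_)
open import Data.Integer as ℤ using (+_)
open import Data.Rational as ℚ using (ℚ)
open import Data.Rational.Properties using (+-*-rawRing)
open import Data.Product using (Σ; _×_; _,_; ∃)
open import Relation.Binary.PropositionalEquality using (_≡_; _≢_)
open import Algebra.Bundles using (CommutativeRing)
open import Algebra.Morphism.Structures using (module RingMorphisms)

ContainsℚVia : ∀ {c ℓ} (R : CommutativeRing c ℓ) → (ℚ → CommutativeRing.Carrier R) → Set ℓ
ContainsℚVia R ι = RingMorphisms.IsRingMonomorphism +-*-rawRing (CommutativeRing.rawRing R) ι

binomThird : ℕ → ℚ
binomThird zero    = ℚ.1ℚ
binomThird (suc k) = binomThird k ℚ.* ((+ 1 ℚ./ 3) ℚ.- (+ k ℚ./ 1)) ℚ.* (+ 1 ℚ./ suc k)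

module TripleRiordan {c ℓ} (R : CommutativeRing c ℓ) (ι : ℚ → CommutativeRing.Carrier R) where
  open CommutativeRing R hiding (zero)

  PS : Set c
  PS = ℕ → Carrier

  _≈ₚ_ : PS → PS → Set ℓ
  a ≈ₚ b = ∀ n → a n ≈ b n

  sumTo : ℕ → (ℕ → Carrier) → Carrier
  sumTo zero    f = f zero
  sumTo (suc n) f = sumTo n f + f (suc n)

  oneₚ : PS
  oneₚ zero    = 1#
  oneₚ (suc _) = 0#

  xₚ : PS
  xₚ zero          = 0#
  xₚ (suc zero)    = 1#
  xₚ (suc (suc _)) = 0#

  _·ₚ_ : PS → PS → PS
  (a ·ₚ b) n = sumTo n (λ i → a i * b (n ∸ i))

  powₚ : PS → ℕ → PS
  powₚ a zero    = oneₚ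
  powₚ a (suc k) = a ·ₚ powₚ a k

  -- composition G(h) (meaningful when h 0 ≈ 0)
  _∘ₚ_ : PS → PS → PS
  (G ∘ₚ h) n = sumTo n (λ k → G k * powₚ h k n)

  dropConst : PS → PS
  dropConst a zero    = 0#
  dropConst a (suc n) = a (suc n)

  divX : PS → PS
  divX a n = a (suc n)

  divX³ : PS → PS
  divX³ a n = a (suc (suc (suc n)))

  mulX : PS → PS
  mulX a zero    = 0#
  mulX a (suc n) = a n

  -- multiplicative inverse of a series with constant term 1:  1/(1+w) = Σ (-1)^k w^k
  altSigns : PS
  altSigns zero          = 1#
  altSigns (suc zero)    = - 1#
  altSigns (suc (suc k)) = altSigns k

  invₚ : PS → PS
  invₚ v = altSigns ∘ₚ dropConst v

  -- cube root of a series with constant term 1:  (1+w)^{1/3} = Σ binom(1/3,k) w^k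
  cbrtₚ : PS → PS
  cbrtₚ u = (λ k → ι (binomThird k)) ∘ₚ dropConst u

  -- h = (f₁f₂f₃)^{1/3} = x + ⋯  (the series x+⋯ whose cube is f₁f₂f₃)
  cubeRootX : PS → PS → PS → PS
  cubeRootX f₁ f₂ f₃ = mulX (cbrtₚ (divX³ (f₁ ·ₚ (f₂ ·ₚ f₃))))

  _/ₓ_ : PS → PS → PS
  f /ₓ h = divX f ·ₚ invₚ (divX h)

  record T4 : Set c where
    constructor ⟨_,_,_,_⟩
    field
      g f₁ f₂ f₃ : PS
  open T4 public

  _≈T_ : T4 → T4 → Set ℓ
  s ≈T t = (g s ≈ₚ g t) × (f₁ s ≈ₚ f₁ t) × (f₂ s ≈ₚ f₂ t) × (f₃ s ≈ₚ f₃ t)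

  IsG : PS → Set ℓ
  IsG a = (a 0 ≈ 1#) × (∀ n → n % 3 ≢ 0 → a n ≈ 0#)

  IsF : PS → Set ℓ
  IsF a = (a 1 ≈ 1#) × (∀ n → n % 3 ≢ 1 → a n ≈ 0#)

  InTR : T4 → Set ℓ
  InTR t = IsG (g t) × IsF (f₁ t) × IsF (f₂ t) × IsF (f₃ t)

  _⊙_ : T4 → T4 → T4
  ⟨ g , f₁ , f₂ , f₃ ⟩ ⊙ ⟨ G , F₁ , F₂ , F₃ ⟩ =
    let h = cubeRootX f₁ f₂ f₃ in
    ⟨ g ·ₚ (G ∘ₚ h) , (f₁ /ₓ h) ·ₚ (F₁ ∘ₚ h) , (f₂ /ₓ h) ·ₚ (F₂ ∘ₚ h) , (f₃ /ₓ h) ·ₚ (F₃ ∘ₚ h) ⟩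

  eT : T4
  eT = ⟨ oneₚ , xₚ , xₚ , xₚ ⟩

  InD : T4 → Set ℓ
  InD t = InTR t × (f₁ t ≈ₚ xₚ) × (f₂ t ≈ₚ xₚ) × (f₃ t ≈ₚ xₚ)

  InA : T4 → Set ℓ
  InA t = InTR t × (g t ≈ₚ oneₚ)

  IsSubgroup : (T4 → Set ℓ) → Set (c ⊔ ℓ)
  IsSubgroup S =
    (∀ s → S s → InTR s) × S eT × (∀ s t → S s → S t → S (s ⊙ t))
    × (∀ s → S s → Σ T4 λ s' → S s' × ((s ⊙ s') ≈T eT) × ((s' ⊙ s) ≈T eT))

  IsNormal : (T4 → Set ℓ) → Set (c ⊔ ℓ)
  IsNormal N = ∀ t n t' → InTR t → InTR t' → N n → (t ⊙ t') ≈T eT → (t' ⊙ t) ≈T eT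
               → N ((t ⊙ n) ⊙ t')

  IsSemidirectProduct : (T4 → Set ℓ) → (T4 → Set ℓ) → Set (c ⊔ ℓ)
  IsSemidirectProduct N H =
    IsSubgroup N × IsSubgroup H × IsNormal N
    × (∀ t → N t → H t → t ≈T eT)
    × (∀ t → InTR t → Σ T4 λ n → Σ T4 λ h → N n × H h × (t ≈T (n ⊙ h)))

{-# OPTIONS --safe #-}

-- Composition with a series of order ≥ 1 is a semiring endomorphism of R[[x]].  A series 1 + w
-- is inverted by Σ (-w)ᵏ, and its cube root is β(w) with β = Σ binom(1/3, k) xᵏ: β and β³ solve
-- Euler-operator equations, and the one for β³ has 1 + x as its unique solution since ℚ ⊆ R.
-- Cube roots with constant term 1 are unique (a² + ab + b² has the unit 3 as constant term), so
-- h = (f₁f₂f₃)^{1/3} is characterised by h³ = f₁f₂f₃; in particular h = x when every fᵢ = x,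
-- which gives the factorisation and the closure and normality of 𝒟.  Inverses in 𝒜 come from
-- the compositional inverse of h.
module Submission where

open import Level using (Level)
open import Data.Bool using (if_then_else_)
open import Data.Empty using (⊥-elim)
open import Data.Integer as ℤ using (+_)
open import Data.Maybe using (nothing)
open import Data.Nat as ℕ using (ℕ; zero; suc; _∸_; z≤n; s≤s)
import Data.Nat.Properties as ℕₚ
open import Data.Nat.DivMod using (_%_; %-distribˡ-+; m%n<n)
open import Data.Product using (_×_; _,_; Σ; proj₁; proj₂)
open import Data.Rational as ℚ using (ℚ; _/_; 1ℚ; toℚᵘ)
import Data.Rational.Properties as ℚₚ
import Data.Rational.Unnormalised as ℚᵘ
import Data.Rational.Unnormalised.Properties as ℚᵘₚ
open import Data.Sum using (inj₁; inj₂)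
open import Relation.Binary.PropositionalEquality as ≡ using (_≡_; _≢_)
open import Relation.Nullary.Decidable using (yes; no; does; dec-true; dec-false)
open import Algebra.Bundles using (CommutativeRing; CommutativeSemiring)
open import Algebra.Morphism.Structures using (module RingMorphisms)
import Algebra.Properties.CommutativeSemigroup as CommutativeSemigroupProperties
import Algebra.Properties.Ring as RingProperties
import Algebra.Solver.Ring.NaturalCoefficients as NaturalCoefficientsSolver
import Relation.Binary.Reasoning.Setoid as SetoidReasoning
import Data.Integer.Tactic.RingSolver as ℤ-Solver
open import Defs

private
  toℚᵘ-/ : ∀ i d → toℚᵘ (i / suc d) ℚᵘ.≃ ℚᵘ.mkℚᵘ i d
  toℚᵘ-/ i d = ℚₚ.toℚᵘ-fromℚᵘ (ℚᵘ.mkℚᵘ i d)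

1/3+1/3+1/3≡1 : (+ 1 / 3) ℚ.+ ((+ 1 / 3) ℚ.+ (+ 1 / 3)) ≡ 1ℚ
1/3+1/3+1/3≡1 = ≡.refl

[1+n]/1≡n/1+1 : ∀ n → (+ suc n / 1) ≡ (+ n / 1) ℚ.+ 1ℚ
[1+n]/1≡n/1+1 n = ℚₚ.toℚᵘ-injective (begin
  toℚᵘ (+ suc n / 1)                             ≈⟨ toℚᵘ-/ (+ suc n) 0 ⟩
  ℚᵘ.mkℚᵘ (+ suc n) 0                            ≈⟨ ℚᵘₚ.≃-reflexive (≡.cong (λ m → ℚᵘ.mkℚᵘ (+ m) 0) (ℕₚ.+-comm 1 n)) ⟩
  ℚᵘ.mkℚᵘ (+ n ℤ.+ + 1) 0                        ≈⟨ ℚᵘ.*≡* (ℤ-solve (+ n)) ⟨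
  ℚᵘ.mkℚᵘ (+ n) 0 ℚᵘ.+ ℚᵘ.mkℚᵘ (+ 1) 0           ≈⟨ ℚᵘₚ.+-cong (toℚᵘ-/ (+ n) 0) (toℚᵘ-/ (+ 1) 0) ⟨
  toℚᵘ (+ n / 1) ℚᵘ.+ toℚᵘ 1ℚ                    ≈⟨ ℚₚ.toℚᵘ-homo-+ (+ n / 1) 1ℚ ⟨
  toℚᵘ ((+ n / 1) ℚ.+ 1ℚ)                        ∎)
  where
  open SetoidReasoning ℚᵘₚ.≃-setoid
  ℤ-solve : ∀ a → (a ℤ.* + 1 ℤ.+ + 1 ℤ.* + 1) ℤ.* + 1 ≡ (a ℤ.+ + 1) ℤ.* (+ 1 ℤ.* + 1)
  ℤ-solve = ℤ-Solver.solve-∀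

[1+n]/1*1/[1+n]≡1 : ∀ n → (+ suc n / 1) ℚ.* (+ 1 / suc n) ≡ 1ℚ
[1+n]/1*1/[1+n]≡1 n = ℚₚ.toℚᵘ-injective (begin
  toℚᵘ ((+ suc n / 1) ℚ.* (+ 1 / suc n))          ≈⟨ ℚₚ.toℚᵘ-homo-* (+ suc n / 1) (+ 1 / suc n) ⟩
  toℚᵘ (+ suc n / 1) ℚᵘ.* toℚᵘ (+ 1 / suc n)     ≈⟨ ℚᵘₚ.*-cong (toℚᵘ-/ (+ suc n) 0) (toℚᵘ-/ (+ 1) n) ⟩
  ℚᵘ.mkℚᵘ (+ suc n) 0 ℚᵘ.* ℚᵘ.mkℚᵘ (+ 1) n       ≈⟨ ℚᵘₚ.*-inverseʳ (ℚᵘ.mkℚᵘ (+ suc n) 0) ⟩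
  toℚᵘ 1ℚ                                        ∎)
  where open SetoidReasoning ℚᵘₚ.≃-setoid

-- Nothing here uses ι; it is a parameter only because TripleRiordan bundles the series
-- operations with the cube root.
module PowerSeries {c ℓ} (R : CommutativeRing c ℓ) (ι : ℚ → CommutativeRing.Carrier R) where
  open CommutativeRing R hiding (zero)
  open TripleRiordan R ι
  open RingProperties ring using (-0#≈0#)
  open CommutativeSemigroupProperties +-commutativeSemigroup using () renaming (interchange to +-interchange)
  open CommutativeSemigroupProperties *-commutativeSemigroup using (x∙yz≈y∙xz) renaming (interchange to *-interchange)

  private
    0+0≈0 : 0# + 0# ≈ 0#
    0+0≈0 = +-identityˡ 0#

  sumTo-cong≤ : ∀ n {f g : ℕ → Carrier} → (∀ i → i ℕ.≤ n → f i ≈ g i) → sumTo n f ≈ sumTo n g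
  sumTo-cong≤ zero    f≈g = f≈g 0 z≤n
  sumTo-cong≤ (suc n) f≈g = +-cong (sumTo-cong≤ n (λ i i≤n → f≈g i (ℕₚ.m≤n⇒m≤1+n i≤n))) (f≈g (suc n) ℕₚ.≤-refl)

  sumTo-cong : ∀ n {f g : ℕ → Carrier} → (∀ i → f i ≈ g i) → sumTo n f ≈ sumTo n g
  sumTo-cong n f≈g = sumTo-cong≤ n (λ i _ → f≈g i)

  sumTo-≈0 : ∀ n {f : ℕ → Carrier} → (∀ i → i ℕ.≤ n → f i ≈ 0#) → sumTo n f ≈ 0#
  sumTo-≈0 n f≈0 = trans (sumTo-cong≤ n f≈0) (sumTo-0 n)
    where
    sumTo-0 : ∀ n → sumTo n (λ _ → 0#) ≈ 0#
    sumTo-0 zero    = refl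
    sumTo-0 (suc n) = trans (+-congʳ (sumTo-0 n)) 0+0≈0

  sumTo-+ : ∀ n (f g : ℕ → Carrier) → sumTo n (λ i → f i + g i) ≈ sumTo n f + sumTo n g
  sumTo-+ zero    f g = refl
  sumTo-+ (suc n) f g = trans (+-congʳ (sumTo-+ n f g)) (+-interchange _ _ _ _)

  *-distribˡ-sumTo : ∀ n a (f : ℕ → Carrier) → a * sumTo n f ≈ sumTo n (λ i → a * f i)
  *-distribˡ-sumTo zero    a f = refl
  *-distribˡ-sumTo (suc n) a f = trans (distribˡ a _ _) (+-congʳ (*-distribˡ-sumTo n a f))

  *-distribʳ-sumTo : ∀ n a (f : ℕ → Carrier) → sumTo n f * a ≈ sumTo n (λ i → f i * a)
  *-distribʳ-sumTo zero    a f = refl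
  *-distribʳ-sumTo (suc n) a f = trans (distribʳ a _ _) (+-congʳ (*-distribʳ-sumTo n a f))

  sumTo-suc : ∀ n (f : ℕ → Carrier) → sumTo (suc n) f ≈ f 0 + sumTo n (λ i → f (suc i))
  sumTo-suc zero    f = refl
  sumTo-suc (suc n) f = trans (+-congʳ (sumTo-suc n f)) (+-assoc _ _ _)

  sumTo-reverse : ∀ n (f : ℕ → Carrier) → sumTo n f ≈ sumTo n (λ i → f (n ∸ i))
  sumTo-reverse zero    f = refl
  sumTo-reverse (suc n) f =
    trans (+-congʳ (sumTo-reverse n f)) (trans (+-comm _ _) (sym (sumTo-suc n (λ i → f (suc n ∸ i)))))

  sumTo-truncate : ∀ {m n} (f : ℕ → Carrier) → m ℕ.≤ n → (∀ i → m ℕ.< i → i ℕ.≤ n → f i ≈ 0#) →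
                   sumTo n f ≈ sumTo m f
  sumTo-truncate {n = zero}  f z≤n _ = refl
  sumTo-truncate {n = suc n} f m≤1+n tail≈0 with ℕₚ.m≤n⇒m<n∨m≡n m≤1+n
  ... | inj₂ ≡.refl      = refl
  ... | inj₁ (s≤s m≤n) =
    trans (+-cong (sumTo-truncate f m≤n (λ i m<i i≤n → tail≈0 i m<i (ℕₚ.m≤n⇒m≤1+n i≤n)))
                  (tail≈0 (suc n) (s≤s m≤n) ℕₚ.≤-refl))
          (+-identityʳ _)

  sumTo-last : ∀ k (f : ℕ → Carrier) → (∀ i → i ℕ.< k → f i ≈ 0#) → sumTo k f ≈ f k
  sumTo-last zero    f _      = refl
  sumTo-last (suc k) f init≈0 = trans (+-congʳ (sumTo-≈0 k (λ i i≤k → init≈0 i (s≤s i≤k)))) (+-identityˡ _)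

  sumTo-single : ∀ n k (f : ℕ → Carrier) → k ℕ.≤ n → (∀ i → i ℕ.≤ n → i ≢ k → f i ≈ 0#) → sumTo n f ≈ f k
  sumTo-single n k f k≤n others≈0 =
    trans (sumTo-truncate f k≤n (λ i k<i i≤n → others≈0 i i≤n (ℕₚ.>⇒≢ k<i)))
          (sumTo-last k f (λ i i<k → others≈0 i (ℕₚ.≤-trans (ℕₚ.<⇒≤ i<k) k≤n) (ℕₚ.<⇒≢ i<k)))

  sumTo-comm : ∀ m n (F : ℕ → ℕ → Carrier) →
               sumTo m (λ i → sumTo n (λ j → F i j)) ≈ sumTo n (λ j → sumTo m (λ i → F i j))
  sumTo-comm zero    n F = refl
  sumTo-comm (suc m) n F = trans (+-congʳ (sumTo-comm m n F)) (sym (sumTo-+ n _ (λ j → F (suc m) j)))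

  sumTo-triangle : ∀ n (F : ℕ → ℕ → Carrier) →
                   sumTo n (λ k → sumTo k (λ i → F i k)) ≈ sumTo n (λ i → sumTo (n ∸ i) (λ j → F i (i ℕ.+ j)))
  sumTo-triangle zero    F = refl
  sumTo-triangle (suc n) F = begin
    sumTo n (λ k → sumTo k (λ i → F i k)) + (sumTo n (λ i → F i (suc n)) + F (suc n) (suc n))
      ≈⟨ +-congʳ (sumTo-triangle n F) ⟩
    sumTo n (λ i → sumTo (n ∸ i) (G i)) + (sumTo n (λ i → F i (suc n)) + F (suc n) (suc n))
      ≈⟨ +-assoc _ _ _ ⟨
    (sumTo n (λ i → sumTo (n ∸ i) (G i)) + sumTo n (λ i → F i (suc n))) + F (suc n) (suc n)
      ≈⟨ +-cong (sumTo-+ n _ _) diagonal ⟨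
    sumTo n (λ i → sumTo (n ∸ i) (G i) + F i (suc n)) + sumTo (suc n ∸ suc n) (G (suc n))
      ≈⟨ +-congʳ (sumTo-cong≤ n row) ⟩
    sumTo n (λ i → sumTo (suc n ∸ i) (G i)) + sumTo (suc n ∸ suc n) (G (suc n)) ∎
    where
    open SetoidReasoning setoid
    G : ℕ → ℕ → Carrier
    G i j = F i (i ℕ.+ j)
    diagonal : sumTo (suc n ∸ suc n) (G (suc n)) ≈ F (suc n) (suc n)
    diagonal rewrite ℕₚ.n∸n≡0 n | ℕₚ.+-identityʳ n = refl
    row : ∀ i → i ℕ.≤ n → sumTo (n ∸ i) (G i) + F i (suc n) ≈ sumTo (suc n ∸ i) (G i)
    row i i≤n rewrite ℕₚ.+-∸-assoc 1 i≤n =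
      +-congˡ (reflexive (≡.cong (F i) (≡.trans (≡.sym (ℕₚ.m+[n∸m]≡n (ℕₚ.m≤n⇒m≤1+n i≤n)))
                                                  (≡.cong (i ℕ.+_) (ℕₚ.+-∸-assoc 1 i≤n)))))

  infixl 6 _+ₚ_
  _+ₚ_ : PS → PS → PS
  (a +ₚ b) n = a n + b n

  zeroₚ : PS
  zeroₚ _ = 0#

  scal : Carrier → PS → PS
  scal k a n = k * a n

  ≈ₚ-refl : ∀ {a} → a ≈ₚ a
  ≈ₚ-refl n = refl

  ≈ₚ-sym : ∀ {a b} → a ≈ₚ b → b ≈ₚ a
  ≈ₚ-sym a≈b n = sym (a≈b n)

  ≈ₚ-trans : ∀ {a b d} → a ≈ₚ b → b ≈ₚ d → a ≈ₚ d
  ≈ₚ-trans a≈b b≈d n = trans (a≈b n) (b≈d n)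

  +ₚ-cong : ∀ {a a′ b b′} → a ≈ₚ a′ → b ≈ₚ b′ → (a +ₚ b) ≈ₚ (a′ +ₚ b′)
  +ₚ-cong a≈a′ b≈b′ n = +-cong (a≈a′ n) (b≈b′ n)

  ·ₚ-cong : ∀ {a a′ b b′} → a ≈ₚ a′ → b ≈ₚ b′ → (a ·ₚ b) ≈ₚ (a′ ·ₚ b′)
  ·ₚ-cong a≈a′ b≈b′ n = sumTo-cong n (λ i → *-cong (a≈a′ i) (b≈b′ (n ∸ i)))

  ·ₚ-congˡ : ∀ a {b b′} → b ≈ₚ b′ → (a ·ₚ b) ≈ₚ (a ·ₚ b′)
  ·ₚ-congˡ a = ·ₚ-cong (≈ₚ-refl {a})

  ·ₚ-congʳ : ∀ b {a a′} → a ≈ₚ a′ → (a ·ₚ b) ≈ₚ (a′ ·ₚ b)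
  ·ₚ-congʳ b a≈a′ = ·ₚ-cong a≈a′ (≈ₚ-refl {b})

  ·ₚ-comm : ∀ a b → (a ·ₚ b) ≈ₚ (b ·ₚ a)
  ·ₚ-comm a b n = trans (sumTo-reverse n _) (sumTo-cong≤ n (λ i i≤n →
    trans (*-comm _ _) (*-congʳ (reflexive (≡.cong b (ℕₚ.m∸[m∸n]≡n i≤n))))))

  ·ₚ-identityˡ : ∀ a → (oneₚ ·ₚ a) ≈ₚ a
  ·ₚ-identityˡ a n = trans (sumTo-single n 0 _ z≤n (λ { zero _ 0≢0 → ⊥-elim (0≢0 ≡.refl) ; (suc i) _ _ → zeroˡ _ }))
                           (*-identityˡ _)

  ·ₚ-identityʳ : ∀ a → (a ·ₚ oneₚ) ≈ₚ a
  ·ₚ-identityʳ a = ≈ₚ-trans (·ₚ-comm a oneₚ) (·ₚ-identityˡ a)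

  ·ₚ-zeroˡ : ∀ a → (zeroₚ ·ₚ a) ≈ₚ zeroₚ
  ·ₚ-zeroˡ a n = sumTo-≈0 n (λ i _ → zeroˡ _)

  ·ₚ-zeroʳ : ∀ a → (a ·ₚ zeroₚ) ≈ₚ zeroₚ
  ·ₚ-zeroʳ a n = sumTo-≈0 n (λ i _ → zeroʳ _)

  ·ₚ-distribˡ : ∀ a b d → (a ·ₚ (b +ₚ d)) ≈ₚ ((a ·ₚ b) +ₚ (a ·ₚ d))
  ·ₚ-distribˡ a b d n = trans (sumTo-cong n (λ i → distribˡ _ _ _)) (sumTo-+ n _ _)

  ·ₚ-distribʳ : ∀ a b d → ((b +ₚ d) ·ₚ a) ≈ₚ ((b ·ₚ a) +ₚ (d ·ₚ a))
  ·ₚ-distribʳ a b d n = trans (sumTo-cong n (λ i → distribʳ _ _ _)) (sumTo-+ n _ _)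

  ·ₚ-assoc : ∀ a b d → ((a ·ₚ b) ·ₚ d) ≈ₚ (a ·ₚ (b ·ₚ d))
  ·ₚ-assoc a b d n = begin
    sumTo n (λ k → sumTo k (λ i → a i * b (k ∸ i)) * d (n ∸ k))
      ≈⟨ sumTo-cong n (λ k → *-distribʳ-sumTo k _ _) ⟩
    sumTo n (λ k → sumTo k (λ i → a i * b (k ∸ i) * d (n ∸ k)))
      ≈⟨ sumTo-triangle n (λ i k → a i * b (k ∸ i) * d (n ∸ k)) ⟩
    sumTo n (λ i → sumTo (n ∸ i) (λ j → a i * b (i ℕ.+ j ∸ i) * d (n ∸ (i ℕ.+ j))))
      ≈⟨ sumTo-cong n (λ i → sumTo-cong (n ∸ i) (λ j → trans (*-assoc _ _ _) (*-congˡ (reindex i j)))) ⟩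
    sumTo n (λ i → sumTo (n ∸ i) (λ j → a i * (b j * d (n ∸ i ∸ j))))
      ≈⟨ sumTo-cong n (λ i → *-distribˡ-sumTo (n ∸ i) _ _) ⟨
    sumTo n (λ i → a i * sumTo (n ∸ i) (λ j → b j * d (n ∸ i ∸ j))) ∎
    where
    open SetoidReasoning setoid
    reindex : ∀ i j → b (i ℕ.+ j ∸ i) * d (n ∸ (i ℕ.+ j)) ≈ b j * d (n ∸ i ∸ j)
    reindex i j rewrite ℕₚ.m+n∸m≡n i j | ℕₚ.∸-+-assoc n i j = refl

  seriesSemiring : CommutativeSemiring c ℓ
  seriesSemiring = record
    { Carrier = PS ; _≈_ = _≈ₚ_ ; _+_ = _+ₚ_ ; _*_ = _·ₚ_ ; 0# = zeroₚ ; 1# = oneₚ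
    ; isCommutativeSemiring = record
      { isSemiring = record
        { isSemiringWithoutAnnihilatingZero = record
          { +-isCommutativeMonoid = record
            { isMonoid = record
              { isSemigroup = record
                { isMagma = record
                  { isEquivalence = record { refl = ≈ₚ-refl ; sym = ≈ₚ-sym ; trans = ≈ₚ-trans }
                  ; ∙-cong = +ₚ-cong }
                ; assoc = λ a b d n → +-assoc (a n) (b n) (d n) }
              ; identity = (λ a n → +-identityˡ (a n)) , (λ a n → +-identityʳ (a n)) }
            ; comm = λ a b n → +-comm (a n) (b n) }
          ; *-cong = ·ₚ-cong
          ; *-assoc = ·ₚ-assoc
          ; *-identity = ·ₚ-identityˡ , ·ₚ-identityʳ
          ; distrib = ·ₚ-distribˡ , ·ₚ-distribʳ }
        ; zero = ·ₚ-zeroˡ , ·ₚ-zeroʳ }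
      ; *-comm = ·ₚ-comm } }

  module ≈ₚ-Reasoning = SetoidReasoning (CommutativeSemiring.setoid seriesSemiring)
  module ·ₚ = CommutativeSemigroupProperties (CommutativeSemiring.*-commutativeSemigroup seriesSemiring)
  module ℙ-Solver = NaturalCoefficientsSolver seriesSemiring (λ _ _ → nothing)

  ·ₚ-interchange₃ : ∀ a₁ a₂ a₃ b₁ b₂ b₃ →
    ((a₁ ·ₚ b₁) ·ₚ ((a₂ ·ₚ b₂) ·ₚ (a₃ ·ₚ b₃))) ≈ₚ ((a₁ ·ₚ (a₂ ·ₚ a₃)) ·ₚ (b₁ ·ₚ (b₂ ·ₚ b₃)))
  ·ₚ-interchange₃ a₁ a₂ a₃ b₁ b₂ b₃ =
    ≈ₚ-trans (·ₚ-congˡ (a₁ ·ₚ b₁) (·ₚ.interchange a₂ b₂ a₃ b₃)) (·ₚ.interchange a₁ b₁ (a₂ ·ₚ a₃) (b₂ ·ₚ b₃))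

  mulX-cong : ∀ {a b} → a ≈ₚ b → mulX a ≈ₚ mulX b
  mulX-cong a≈b zero    = refl
  mulX-cong a≈b (suc n) = a≈b n

  divX-cong : ∀ {a b} → a ≈ₚ b → divX a ≈ₚ divX b
  divX-cong a≈b n = a≈b (suc n)

  divX³-cong : ∀ {a b} → a ≈ₚ b → divX³ a ≈ₚ divX³ b
  divX³-cong a≈b n = a≈b (suc (suc (suc n)))

  dropConst-cong : ∀ {a b} → a ≈ₚ b → dropConst a ≈ₚ dropConst b
  dropConst-cong a≈b zero    = refl
  dropConst-cong a≈b (suc n) = a≈b (suc n)

  mulX-+ₚ : ∀ a b → mulX (a +ₚ b) ≈ₚ (mulX a +ₚ mulX b)
  mulX-+ₚ a b zero    = sym 0+0≈0
  mulX-+ₚ a b (suc n) = refl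

  mulX-·ₚˡ : ∀ a b → (mulX a ·ₚ b) ≈ₚ mulX (a ·ₚ b)
  mulX-·ₚˡ a b zero    = zeroˡ _
  mulX-·ₚˡ a b (suc n) = trans (sumTo-suc n _) (trans (+-congʳ (zeroˡ _)) (+-identityˡ _))

  mulX-·ₚʳ : ∀ a b → (a ·ₚ mulX b) ≈ₚ mulX (a ·ₚ b)
  mulX-·ₚʳ a b = ≈ₚ-trans (·ₚ-comm a (mulX b)) (≈ₚ-trans (mulX-·ₚˡ b a) (mulX-cong (·ₚ-comm b a)))

  xₚ≈mulX-oneₚ : xₚ ≈ₚ mulX oneₚ
  xₚ≈mulX-oneₚ zero          = refl
  xₚ≈mulX-oneₚ (suc zero)    = refl
  xₚ≈mulX-oneₚ (suc (suc n)) = refl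

  xₚ-·ₚ : ∀ a → (xₚ ·ₚ a) ≈ₚ mulX a
  xₚ-·ₚ a = ≈ₚ-trans (·ₚ-congʳ a xₚ≈mulX-oneₚ) (≈ₚ-trans (mulX-·ₚˡ oneₚ a) (mulX-cong (·ₚ-identityˡ a)))

  mulX-divX : ∀ a → a 0 ≈ 0# → mulX (divX a) ≈ₚ a
  mulX-divX a a₀≈0 zero    = sym a₀≈0
  mulX-divX a a₀≈0 (suc n) = refl

  divX-·ₚˡ : ∀ a b → a 0 ≈ 0# → divX (a ·ₚ b) ≈ₚ (divX a ·ₚ b)
  divX-·ₚˡ a b a₀≈0 n = trans (·ₚ-congʳ b (≈ₚ-sym (mulX-divX a a₀≈0)) (suc n)) (mulX-·ₚˡ (divX a) b (suc n))

  divX-xₚ : divX xₚ ≈ₚ oneₚ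
  divX-xₚ zero    = refl
  divX-xₚ (suc n) = refl

  divX³-·ₚ : ∀ a b d → a 0 ≈ 0# → b 0 ≈ 0# → d 0 ≈ 0# →
             divX³ (a ·ₚ (b ·ₚ d)) ≈ₚ (divX a ·ₚ (divX b ·ₚ divX d))
  divX³-·ₚ a b d a₀≈0 b₀≈0 d₀≈0 = divX³-cong (begin
    a ·ₚ (b ·ₚ d)
      ≈⟨ ·ₚ-cong (mulX-divX a a₀≈0) (·ₚ-cong (mulX-divX b b₀≈0) (mulX-divX d d₀≈0)) ⟨
    mulX a′ ·ₚ (mulX b′ ·ₚ mulX d′)                         ≈⟨ ·ₚ-congˡ (mulX a′) (mulX-·ₚˡ b′ (mulX d′)) ⟩
    mulX a′ ·ₚ mulX (b′ ·ₚ mulX d′)                         ≈⟨ ·ₚ-congˡ (mulX a′) (mulX-cong (mulX-·ₚʳ b′ d′)) ⟩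
    mulX a′ ·ₚ mulX (mulX (b′ ·ₚ d′))                       ≈⟨ mulX-·ₚˡ a′ (mulX (mulX (b′ ·ₚ d′))) ⟩
    mulX (a′ ·ₚ mulX (mulX (b′ ·ₚ d′)))                     ≈⟨ mulX-cong (mulX-·ₚʳ a′ (mulX (b′ ·ₚ d′))) ⟩
    mulX (mulX (a′ ·ₚ mulX (b′ ·ₚ d′)))                     ≈⟨ mulX-cong (mulX-cong (mulX-·ₚʳ a′ (b′ ·ₚ d′))) ⟩
    mulX (mulX (mulX (a′ ·ₚ (b′ ·ₚ d′))))                   ∎)
    where
    open ≈ₚ-Reasoning
    a′ = divX a
    b′ = divX b
    d′ = divX d

  powₚ-cong : ∀ {h h′} → h ≈ₚ h′ → ∀ k → powₚ h k ≈ₚ powₚ h′ k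
  powₚ-cong h≈h′ zero    = ≈ₚ-refl
  powₚ-cong h≈h′ (suc k) = ·ₚ-cong h≈h′ (powₚ-cong h≈h′ k)

  powₚ-+ : ∀ h j k → powₚ h (j ℕ.+ k) ≈ₚ (powₚ h j ·ₚ powₚ h k)
  powₚ-+ h zero    k = ≈ₚ-sym (·ₚ-identityˡ (powₚ h k))
  powₚ-+ h (suc j) k = ≈ₚ-trans (·ₚ-congˡ h (powₚ-+ h j k)) (≈ₚ-sym (·ₚ-assoc h (powₚ h j) (powₚ h k)))

  powₚ-order : ∀ {h} → h 0 ≈ 0# → ∀ k n → n ℕ.< k → powₚ h k n ≈ 0#
  powₚ-order {h} h₀≈0 (suc k) n (s≤s n≤k) = sumTo-≈0 n (λ i i≤n → term n i i≤n n≤k)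
    where
    term : ∀ n i → i ℕ.≤ n → n ℕ.≤ k → h i * powₚ h k (n ∸ i) ≈ 0#
    term n       zero    _         _   = trans (*-congʳ h₀≈0) (zeroˡ _)
    term (suc n) (suc i) (s≤s i≤n) n<k =
      trans (*-congˡ (powₚ-order h₀≈0 k (n ∸ i) (ℕₚ.≤-<-trans (ℕₚ.m∸n≤m n i) n<k))) (zeroʳ _)

  powₚ-diagonal : ∀ {h} → h 0 ≈ 0# → h 1 ≈ 1# → ∀ k → powₚ h k k ≈ 1#
  powₚ-diagonal h₀≈0 h₁≈1 zero    = refl
  powₚ-diagonal {h} h₀≈0 h₁≈1 (suc k) =
    trans (sumTo-single (suc k) 1 _ (s≤s z≤n) term)
          (trans (*-cong h₁≈1 (powₚ-diagonal h₀≈0 h₁≈1 k)) (*-identityˡ 1#))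
    where
    term : ∀ i → i ℕ.≤ suc k → i ≢ 1 → h i * powₚ h k (suc k ∸ i) ≈ 0#
    term zero          _             _   = trans (*-congʳ h₀≈0) (zeroˡ _)
    term (suc zero)    _             1≢1 = ⊥-elim (1≢1 ≡.refl)
    term (suc (suc i)) (s≤s (s≤s {n = k′} _)) _ =
      trans (*-congˡ (powₚ-order h₀≈0 (suc k′) (k′ ∸ i) (s≤s (ℕₚ.m∸n≤m k′ i)))) (zeroʳ _)

  ∘ₚ-cong : ∀ {G G′ h h′} → G ≈ₚ G′ → h ≈ₚ h′ → (G ∘ₚ h) ≈ₚ (G′ ∘ₚ h′)
  ∘ₚ-cong G≈G′ h≈h′ n = sumTo-cong n (λ k → *-cong (G≈G′ k) (powₚ-cong h≈h′ k n))

  ∘ₚ-congˡ : ∀ {G G′} h → G ≈ₚ G′ → (G ∘ₚ h) ≈ₚ (G′ ∘ₚ h)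
  ∘ₚ-congˡ h G≈G′ = ∘ₚ-cong G≈G′ (≈ₚ-refl {h})

  ∘ₚ-congʳ : ∀ G {h h′} → h ≈ₚ h′ → (G ∘ₚ h) ≈ₚ (G ∘ₚ h′)
  ∘ₚ-congʳ G = ∘ₚ-cong (≈ₚ-refl {G})

  ∘ₚ-extend : ∀ {h} → h 0 ≈ 0# → ∀ G n m → n ℕ.≤ m → (G ∘ₚ h) n ≈ sumTo m (λ k → G k * powₚ h k n)
  ∘ₚ-extend h₀≈0 G n m n≤m =
    sym (sumTo-truncate _ n≤m (λ k n<k _ → trans (*-congˡ (powₚ-order h₀≈0 k n n<k)) (zeroʳ _)))

  oneₚ-∘ₚ : ∀ h → (oneₚ ∘ₚ h) ≈ₚ oneₚ
  oneₚ-∘ₚ h n = trans (sumTo-single n 0 _ z≤n (λ { zero _ 0≢0 → ⊥-elim (0≢0 ≡.refl) ; (suc i) _ _ → zeroˡ _ }))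
                      (*-identityˡ _)

  ∘ₚ-+ₚ : ∀ a b h → ((a +ₚ b) ∘ₚ h) ≈ₚ ((a ∘ₚ h) +ₚ (b ∘ₚ h))
  ∘ₚ-+ₚ a b h n = trans (sumTo-cong n (λ k → distribʳ _ _ _)) (sumTo-+ n _ _)

  ∘ₚ-·ₚ : ∀ {h} → h 0 ≈ 0# → ∀ a b → ((a ·ₚ b) ∘ₚ h) ≈ₚ ((a ∘ₚ h) ·ₚ (b ∘ₚ h))
  ∘ₚ-·ₚ {h} h₀≈0 a b n = trans byDegree (sym byFactors)
    where
    open SetoidReasoning setoid
    T : ℕ → ℕ → Carrier
    T j k = (a j * b k) * powₚ h (j ℕ.+ k) n
    byDegree : ((a ·ₚ b) ∘ₚ h) n ≈ sumTo n (λ j → sumTo n (λ k → T j k))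
    byDegree = begin
      sumTo n (λ l → sumTo l (λ j → a j * b (l ∸ j)) * powₚ h l n)
        ≈⟨ sumTo-cong n (λ l → *-distribʳ-sumTo l _ _) ⟩
      sumTo n (λ l → sumTo l (λ j → a j * b (l ∸ j) * powₚ h l n))
        ≈⟨ sumTo-triangle n (λ j l → a j * b (l ∸ j) * powₚ h l n) ⟩
      sumTo n (λ j → sumTo (n ∸ j) (λ k → a j * b (j ℕ.+ k ∸ j) * powₚ h (j ℕ.+ k) n))
        ≈⟨ sumTo-cong≤ n (λ j j≤n → trans (sumTo-cong (n ∸ j) (λ k → reindex j k)) (sym (pad j j≤n))) ⟩
      sumTo n (λ j → sumTo n (λ k → T j k)) ∎
      where
      reindex : ∀ j k → a j * b (j ℕ.+ k ∸ j) * powₚ h (j ℕ.+ k) n ≈ T j k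
      reindex j k rewrite ℕₚ.m+n∸m≡n j k = refl
      pad : ∀ j → j ℕ.≤ n → sumTo n (T j) ≈ sumTo (n ∸ j) (T j)
      pad j j≤n = sumTo-truncate (T j) (ℕₚ.m∸n≤m n j) (λ k n∸j<k _ →
        trans (*-congˡ (powₚ-order h₀≈0 (j ℕ.+ k) n
                  (≡.subst (ℕ._< j ℕ.+ k) (ℕₚ.m+[n∸m]≡n j≤n) (ℕₚ.+-monoʳ-< j n∸j<k))))
              (zeroʳ _))
    byFactors : ((a ∘ₚ h) ·ₚ (b ∘ₚ h)) n ≈ sumTo n (λ j → sumTo n (λ k → T j k))
    byFactors = begin
      sumTo n (λ m → (a ∘ₚ h) m * (b ∘ₚ h) (n ∸ m))
        ≈⟨ sumTo-cong≤ n (λ m m≤n → *-cong (∘ₚ-extend h₀≈0 a m n m≤n) (∘ₚ-extend h₀≈0 b (n ∸ m) n (ℕₚ.m∸n≤m n m))) ⟩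
      sumTo n (λ m → sumTo n (λ j → a j * powₚ h j m) * sumTo n (λ k → b k * powₚ h k (n ∸ m)))
        ≈⟨ sumTo-cong n (λ m → trans (*-distribʳ-sumTo n _ _) (sumTo-cong n (λ j → *-distribˡ-sumTo n _ _))) ⟩
      sumTo n (λ m → sumTo n (λ j → sumTo n (λ k → (a j * powₚ h j m) * (b k * powₚ h k (n ∸ m)))))
        ≈⟨ sumTo-comm n n _ ⟩
      sumTo n (λ j → sumTo n (λ m → sumTo n (λ k → (a j * powₚ h j m) * (b k * powₚ h k (n ∸ m)))))
        ≈⟨ sumTo-cong n (λ j → sumTo-comm n n _) ⟩
      sumTo n (λ j → sumTo n (λ k → sumTo n (λ m → (a j * powₚ h j m) * (b k * powₚ h k (n ∸ m)))))
        ≈⟨ sumTo-cong n (λ j → sumTo-cong n (λ k →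
             trans (sumTo-cong n (λ m → *-interchange _ _ _ _)) (sym (*-distribˡ-sumTo n _ _)))) ⟩
      sumTo n (λ j → sumTo n (λ k → (a j * b k) * (powₚ h j ·ₚ powₚ h k) n))
        ≈⟨ sumTo-cong n (λ j → sumTo-cong n (λ k → *-congˡ (sym (powₚ-+ h j k n)))) ⟩
      sumTo n (λ j → sumTo n (λ k → T j k)) ∎

  ∘ₚ-·ₚ₃ : ∀ {h} → h 0 ≈ 0# → ∀ a b d → ((a ·ₚ (b ·ₚ d)) ∘ₚ h) ≈ₚ ((a ∘ₚ h) ·ₚ ((b ∘ₚ h) ·ₚ (d ∘ₚ h)))
  ∘ₚ-·ₚ₃ {h} h₀≈0 a b d = ≈ₚ-trans (∘ₚ-·ₚ h₀≈0 a (b ·ₚ d)) (·ₚ-congˡ (a ∘ₚ h) (∘ₚ-·ₚ h₀≈0 b d))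

  xₚ-∘ₚ : ∀ {h} → h 0 ≈ 0# → (xₚ ∘ₚ h) ≈ₚ h
  xₚ-∘ₚ h₀≈0 zero    = trans (zeroˡ _) (sym h₀≈0)
  xₚ-∘ₚ {h} h₀≈0 (suc n) =
    trans (sumTo-single (suc n) 1 _ (s≤s z≤n) others) (trans (*-identityˡ _) (·ₚ-identityʳ h (suc n)))
    where
    others : ∀ i → i ℕ.≤ suc n → i ≢ 1 → xₚ i * powₚ h i (suc n) ≈ 0#
    others zero          _ _   = zeroˡ _
    others (suc zero)    _ 1≢1 = ⊥-elim (1≢1 ≡.refl)
    others (suc (suc i)) _ _   = zeroˡ _

  powₚ-xₚ-offDiagonal : ∀ j n → j ≢ n → powₚ xₚ j n ≈ 0#
  powₚ-xₚ-offDiagonal zero    zero    0≢0 = ⊥-elim (0≢0 ≡.refl)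
  powₚ-xₚ-offDiagonal zero    (suc n) _   = refl
  powₚ-xₚ-offDiagonal (suc j) zero    _   = xₚ-·ₚ (powₚ xₚ j) zero
  powₚ-xₚ-offDiagonal (suc j) (suc n) j≢n =
    trans (xₚ-·ₚ (powₚ xₚ j) (suc n)) (powₚ-xₚ-offDiagonal j n (λ j≡n → j≢n (≡.cong suc j≡n)))

  ∘ₚ-xₚ : ∀ a → (a ∘ₚ xₚ) ≈ₚ a
  ∘ₚ-xₚ a n = trans (sumTo-single n n _ ℕₚ.≤-refl (λ i _ i≢n → trans (*-congˡ (powₚ-xₚ-offDiagonal i n i≢n)) (zeroʳ _)))
                    (trans (*-congˡ (powₚ-diagonal {xₚ} refl refl n)) (*-identityʳ _))

  powₚ-∘ₚ : ∀ {k} → k 0 ≈ 0# → ∀ h j → (powₚ h j ∘ₚ k) ≈ₚ powₚ (h ∘ₚ k) j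
  powₚ-∘ₚ {k} k₀≈0 h zero    = oneₚ-∘ₚ k
  powₚ-∘ₚ {k} k₀≈0 h (suc j) = ≈ₚ-trans (∘ₚ-·ₚ k₀≈0 h (powₚ h j)) (·ₚ-congˡ (h ∘ₚ k) (powₚ-∘ₚ k₀≈0 h j))

  ∘ₚ-assoc : ∀ {h k} → h 0 ≈ 0# → k 0 ≈ 0# → ∀ a → ((a ∘ₚ h) ∘ₚ k) ≈ₚ (a ∘ₚ (h ∘ₚ k))
  ∘ₚ-assoc {h} {k} h₀≈0 k₀≈0 a n = begin
    sumTo n (λ m → (a ∘ₚ h) m * powₚ k m n)
      ≈⟨ sumTo-cong≤ n (λ m m≤n → *-congʳ (∘ₚ-extend h₀≈0 a m n m≤n)) ⟩
    sumTo n (λ m → sumTo n (λ j → a j * powₚ h j m) * powₚ k m n)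
      ≈⟨ sumTo-cong n (λ m → *-distribʳ-sumTo n _ _) ⟩
    sumTo n (λ m → sumTo n (λ j → a j * powₚ h j m * powₚ k m n))
      ≈⟨ sumTo-comm n n _ ⟩
    sumTo n (λ j → sumTo n (λ m → a j * powₚ h j m * powₚ k m n))
      ≈⟨ sumTo-cong n (λ j → trans (sumTo-cong n (λ m → *-assoc _ _ _)) (sym (*-distribˡ-sumTo n _ _))) ⟩
    sumTo n (λ j → a j * (powₚ h j ∘ₚ k) n)
      ≈⟨ sumTo-cong n (λ j → *-congˡ (powₚ-∘ₚ k₀≈0 h j n)) ⟩
    sumTo n (λ j → a j * powₚ (h ∘ₚ k) j n) ∎
    where open SetoidReasoning setoid

  mulX-∘ₚ : ∀ {h} → h 0 ≈ 0# → ∀ a → (mulX a ∘ₚ h) ≈ₚ (h ·ₚ (a ∘ₚ h))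
  mulX-∘ₚ {h} h₀≈0 a = begin
    mulX a ∘ₚ h             ≈⟨ ∘ₚ-congˡ h (xₚ-·ₚ a) ⟨
    (xₚ ·ₚ a) ∘ₚ h          ≈⟨ ∘ₚ-·ₚ h₀≈0 xₚ a ⟩
    (xₚ ∘ₚ h) ·ₚ (a ∘ₚ h)   ≈⟨ ·ₚ-congʳ (a ∘ₚ h) (xₚ-∘ₚ h₀≈0) ⟩
    h ·ₚ (a ∘ₚ h)           ∎
    where open ≈ₚ-Reasoning

  [1+x]·altSigns≈1 : ((oneₚ +ₚ xₚ) ·ₚ altSigns) ≈ₚ oneₚ
  [1+x]·altSigns≈1 = ≈ₚ-trans (·ₚ-distribʳ altSigns oneₚ xₚ)
                              (λ n → trans (+-cong (·ₚ-identityˡ altSigns n) (xₚ-·ₚ altSigns n)) (telescope n))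
    where
    cancel : ∀ k → altSigns (suc k) + altSigns k ≈ 0#
    cancel zero          = -‿inverseˡ 1#
    cancel (suc zero)    = -‿inverseʳ 1#
    cancel (suc (suc k)) = cancel k
    telescope : ∀ n → altSigns n + mulX altSigns n ≈ oneₚ n
    telescope zero          = +-identityʳ 1#
    telescope (suc zero)    = -‿inverseˡ 1#
    telescope (suc (suc k)) = trans (+-comm _ _) (cancel k)

  [1+x]∘ₚdropConst : ∀ v → v 0 ≈ 1# → v ≈ₚ ((oneₚ +ₚ xₚ) ∘ₚ dropConst v)
  [1+x]∘ₚdropConst v v₀≈1 n = trans (split n) (sym (trans (∘ₚ-+ₚ oneₚ xₚ w n) (+-cong (oneₚ-∘ₚ w n) (xₚ-∘ₚ {w} refl n))))
    where
    w = dropConst v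
    split : v ≈ₚ (oneₚ +ₚ w)
    split zero    = trans v₀≈1 (sym (+-identityʳ 1#))
    split (suc n) = sym (+-identityˡ _)

  invₚ-inverseʳ : ∀ v → v 0 ≈ 1# → (v ·ₚ invₚ v) ≈ₚ oneₚ
  invₚ-inverseʳ v v₀≈1 = begin
    v ·ₚ (altSigns ∘ₚ w)                              ≈⟨ ·ₚ-congʳ (altSigns ∘ₚ w) ([1+x]∘ₚdropConst v v₀≈1) ⟩
    ((oneₚ +ₚ xₚ) ∘ₚ w) ·ₚ (altSigns ∘ₚ w)            ≈⟨ ∘ₚ-·ₚ {w} refl (oneₚ +ₚ xₚ) altSigns ⟨
    ((oneₚ +ₚ xₚ) ·ₚ altSigns) ∘ₚ w                   ≈⟨ ∘ₚ-congˡ w [1+x]·altSigns≈1 ⟩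
    oneₚ ∘ₚ w                                         ≈⟨ oneₚ-∘ₚ w ⟩
    oneₚ                                              ∎
    where
    open ≈ₚ-Reasoning
    w = dropConst v

  invₚ-inverseˡ : ∀ v → v 0 ≈ 1# → (invₚ v ·ₚ v) ≈ₚ oneₚ
  invₚ-inverseˡ v v₀≈1 = ≈ₚ-trans (·ₚ-comm (invₚ v) v) (invₚ-inverseʳ v v₀≈1)

  invₚ-constant : ∀ v → invₚ v 0 ≈ 1#
  invₚ-constant v = *-identityʳ 1#

  invₚ-cong : ∀ {u v} → u ≈ₚ v → invₚ u ≈ₚ invₚ v
  invₚ-cong u≈v = ∘ₚ-congʳ altSigns (dropConst-cong u≈v)

  invₚ-oneₚ : invₚ oneₚ ≈ₚ oneₚ
  invₚ-oneₚ = ≈ₚ-trans (≈ₚ-sym (·ₚ-identityˡ (invₚ oneₚ))) (invₚ-inverseʳ oneₚ refl)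

  /ₓ-cong : ∀ {f f′ h h′} → f ≈ₚ f′ → h ≈ₚ h′ → (f /ₓ h) ≈ₚ (f′ /ₓ h′)
  /ₓ-cong f≈f′ h≈h′ = ·ₚ-cong (divX-cong f≈f′) (invₚ-cong (divX-cong h≈h′))

  h·ₚ[f/ₓh]≈f : ∀ f h → f 0 ≈ 0# → h 0 ≈ 0# → h 1 ≈ 1# → (h ·ₚ (f /ₓ h)) ≈ₚ f
  h·ₚ[f/ₓh]≈f f h f₀≈0 h₀≈0 h₁≈1 = begin
    h ·ₚ (divX f ·ₚ invₚ (divX h))              ≈⟨ ·ₚ-congʳ (f /ₓ h) (mulX-divX h h₀≈0) ⟨
    mulX (divX h) ·ₚ (divX f ·ₚ invₚ (divX h))  ≈⟨ mulX-·ₚˡ (divX h) (f /ₓ h) ⟩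
    mulX (divX h ·ₚ (divX f ·ₚ invₚ (divX h)))  ≈⟨ mulX-cong (·ₚ.x∙yz≈y∙xz (divX h) (divX f) (invₚ (divX h))) ⟩
    mulX (divX f ·ₚ (divX h ·ₚ invₚ (divX h)))  ≈⟨ mulX-cong (·ₚ-congˡ (divX f) (invₚ-inverseʳ (divX h) h₁≈1)) ⟩
    mulX (divX f ·ₚ oneₚ)                       ≈⟨ mulX-cong (·ₚ-identityʳ (divX f)) ⟩
    mulX (divX f)                               ≈⟨ mulX-divX f f₀≈0 ⟩
    f                                           ∎
    where open ≈ₚ-Reasoning

  [h·ₚr]/ₓh≈r : ∀ h r → h 0 ≈ 0# → h 1 ≈ 1# → ((h ·ₚ r) /ₓ h) ≈ₚ r
  [h·ₚr]/ₓh≈r h r h₀≈0 h₁≈1 = begin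
    divX (h ·ₚ r) ·ₚ invₚ (divX h)          ≈⟨ ·ₚ-congʳ (invₚ (divX h)) (divX-·ₚˡ h r h₀≈0) ⟩
    (divX h ·ₚ r) ·ₚ invₚ (divX h)          ≈⟨ ·ₚ.xy∙z≈y∙xz (divX h) r (invₚ (divX h)) ⟩
    r ·ₚ (divX h ·ₚ invₚ (divX h))          ≈⟨ ·ₚ-congˡ r (invₚ-inverseʳ (divX h) h₁≈1) ⟩
    r ·ₚ oneₚ                               ≈⟨ ·ₚ-identityʳ r ⟩
    r                                       ∎
    where open ≈ₚ-Reasoning

  scal-·ₚˡ : ∀ r a b → scal r (a ·ₚ b) ≈ₚ (scal r a ·ₚ b)
  scal-·ₚˡ r a b n = trans (*-distribˡ-sumTo n r _) (sumTo-cong n (λ i → sym (*-assoc _ _ _)))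

  scal-·ₚʳ : ∀ r a b → scal r (a ·ₚ b) ≈ₚ (a ·ₚ scal r b)
  scal-·ₚʳ r a b n = trans (*-distribˡ-sumTo n r _) (sumTo-cong n (λ i → x∙yz≈y∙xz _ _ _))

  ·ₚ-cancelʳ : ∀ {a b} Q {r} → r * Q 0 ≈ 1# → (a ·ₚ Q) ≈ₚ (b ·ₚ Q) → a ≈ₚ b
  ·ₚ-cancelʳ {a} {b} Q {r} rQ₀≈1 aQ≈bQ =
    ≈ₚ-trans (viaQ a) (≈ₚ-trans (·ₚ-congʳ (invₚ (scal r Q)) r[aQ]≈r[bQ]) (≈ₚ-sym (viaQ b)))
    where
    open ≈ₚ-Reasoning
    r[aQ]≈r[bQ] : scal r (a ·ₚ Q) ≈ₚ scal r (b ·ₚ Q)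
    r[aQ]≈r[bQ] n = *-congˡ (aQ≈bQ n)
    viaQ : ∀ d → d ≈ₚ (scal r (d ·ₚ Q) ·ₚ invₚ (scal r Q))
    viaQ d = begin
      d                                           ≈⟨ ·ₚ-identityʳ d ⟨
      d ·ₚ oneₚ                                   ≈⟨ ·ₚ-congˡ d (invₚ-inverseʳ (scal r Q) rQ₀≈1) ⟨
      d ·ₚ (scal r Q ·ₚ invₚ (scal r Q))          ≈⟨ ·ₚ-assoc d (scal r Q) (invₚ (scal r Q)) ⟨
      (d ·ₚ scal r Q) ·ₚ invₚ (scal r Q)          ≈⟨ ·ₚ-congʳ (invₚ (scal r Q)) (scal-·ₚʳ r d Q) ⟨
      scal r (d ·ₚ Q) ·ₚ invₚ (scal r Q)          ∎

  -- Stage n fixes the coefficients 0, …, n of the reversion; stage n + 1 keeps them and solves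
  -- the degree-(n + 1) coefficient of (revert h ∘ₚ h) ≈ₚ xₚ for the next one.
  revertStage : PS → ℕ → PS
  revertStage h zero    k = 0#
  revertStage h (suc n) k =
    if does (k ℕ.≤? n) then revertStage h n k
    else xₚ (suc n) - sumTo n (λ j → revertStage h n j * powₚ h j (suc n))

  revert : PS → PS
  revert h k = revertStage h k k

  revertStage-stable : ∀ h {n k} → k ℕ.≤ n → revertStage h n k ≡ revert h k
  revertStage-stable h {zero}  z≤n = ≡.refl
  revertStage-stable h {suc n} {k} k≤1+n with ℕₚ.m≤n⇒m<n∨m≡n k≤1+n
  ... | inj₂ ≡.refl    = ≡.refl
  ... | inj₁ (s≤s k≤n) rewrite dec-true (k ℕ.≤? n) k≤n = revertStage-stable h k≤n

  revert-suc : ∀ h n → revert h (suc n) ≈ xₚ (suc n) - sumTo n (λ j → revert h j * powₚ h j (suc n))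
  revert-suc h n rewrite dec-false (suc n ℕ.≤? n) (ℕₚ.n≮n n) =
    +-congˡ (-‿cong (sumTo-cong≤ n (λ j j≤n → *-congʳ (reflexive (revertStage-stable h j≤n)))))

  revert-linear : ∀ h → revert h 1 ≈ 1#
  revert-linear h = trans (revert-suc h 0) (trans (+-congˡ (trans (-‿cong (zeroˡ _)) -0#≈0#)) (+-identityʳ 1#))

  revert-∘ₚ : ∀ h → h 0 ≈ 0# → h 1 ≈ 1# → (revert h ∘ₚ h) ≈ₚ xₚ
  revert-∘ₚ h h₀≈0 h₁≈1 zero    = zeroˡ _
  revert-∘ₚ h h₀≈0 h₁≈1 (suc n) = begin
    S + revert h (suc n) * powₚ h (suc n) (suc n)   ≈⟨ +-congˡ (*-cong (revert-suc h n) (powₚ-diagonal h₀≈0 h₁≈1 (suc n))) ⟩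
    S + (xₚ (suc n) - S) * 1#                      ≈⟨ +-congˡ (*-identityʳ _) ⟩
    S + (xₚ (suc n) - S)                           ≈⟨ +-congˡ (+-comm _ _) ⟩
    S + (- S + xₚ (suc n))                         ≈⟨ +-assoc _ _ _ ⟨
    (S - S) + xₚ (suc n)                           ≈⟨ +-congʳ (-‿inverseʳ S) ⟩
    0# + xₚ (suc n)                                ≈⟨ +-identityˡ _ ⟩
    xₚ (suc n)                                     ∎
    where
    open SetoidReasoning setoid
    S = sumTo n (λ j → revert h j * powₚ h j (suc n))

  ∘ₚ-revert : ∀ h → h 0 ≈ 0# → h 1 ≈ 1# → (h ∘ₚ revert h) ≈ₚ xₚ
  ∘ₚ-revert h h₀≈0 h₁≈1 = ≈ₚ-trans (∘ₚ-congˡ h̄ h≈k) (revert-∘ₚ h̄ refl (revert-linear h))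
    where
    open ≈ₚ-Reasoning
    h̄ = revert h
    k = revert h̄
    h≈k : h ≈ₚ k
    h≈k = begin
      h                      ≈⟨ xₚ-∘ₚ h₀≈0 ⟨
      xₚ ∘ₚ h                ≈⟨ ∘ₚ-congˡ h (revert-∘ₚ h̄ refl (revert-linear h)) ⟨
      (k ∘ₚ h̄) ∘ₚ h          ≈⟨ ∘ₚ-assoc refl h₀≈0 k ⟩
      k ∘ₚ (h̄ ∘ₚ h)          ≈⟨ ∘ₚ-congʳ k (revert-∘ₚ h h₀≈0 h₁≈1) ⟩
      k ∘ₚ xₚ                ≈⟨ ∘ₚ-xₚ k ⟩
      k                      ∎

  Mod3Support : ℕ → PS → Set ℓ
  Mod3Support r a = ∀ n → n % 3 ≢ r → a n ≈ 0#

  private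
    [1+n]%3≡1⇒n%3≡0 : ∀ n → suc n % 3 ≡ 1 → n % 3 ≡ 0
    [1+n]%3≡1⇒n%3≡0 n [1+n]%3≡1 = residue (n % 3) (m%n<n n 3) (≡.trans (≡.sym (%-distribˡ-+ 1 n 3)) [1+n]%3≡1)
      where
      residue : ∀ r → r ℕ.< 3 → suc r % 3 ≡ 1 → r ≡ 0
      residue zero                _                        _  = ≡.refl
      residue (suc zero)          _                        ()
      residue (suc (suc zero))    _                        ()
      residue (suc (suc (suc r))) (s≤s (s≤s (s≤s ()))) _

    n%3≡0⇒[1+n]%3≡1 : ∀ n → n % 3 ≡ 0 → suc n % 3 ≡ 1
    n%3≡0⇒[1+n]%3≡1 n n%3≡0 = ≡.trans (%-distribˡ-+ 1 n 3) (≡.cong (λ r → suc r % 3) n%3≡0)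

  Mod3Support-cong : ∀ {r a b} → a ≈ₚ b → Mod3Support r a → Mod3Support r b
  Mod3Support-cong a≈b supp n n≢r = trans (sym (a≈b n)) (supp n n≢r)

  Mod3Support-·ₚ : ∀ {r s a b} → Mod3Support r a → Mod3Support s b → Mod3Support ((r ℕ.+ s) % 3) (a ·ₚ b)
  Mod3Support-·ₚ {r} {s} {a} {b} suppa suppb n n≢r+s = sumTo-≈0 n term
    where
    term : ∀ i → i ℕ.≤ n → a i * b (n ∸ i) ≈ 0#
    term i i≤n with i % 3 ℕ.≟ r | (n ∸ i) % 3 ℕ.≟ s
    ... | no i≢r | _          = trans (*-congʳ (suppa i i≢r)) (zeroˡ _)
    ... | yes _  | no n∸i≢s   = trans (*-congˡ (suppb (n ∸ i) n∸i≢s)) (zeroʳ _)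
    ... | yes i≡r | yes n∸i≡s = ⊥-elim (n≢r+s (begin
      n % 3                            ≡⟨ ≡.cong (_% 3) (ℕₚ.m+[n∸m]≡n i≤n) ⟨
      (i ℕ.+ (n ∸ i)) % 3              ≡⟨ %-distribˡ-+ i (n ∸ i) 3 ⟩
      (i % 3 ℕ.+ (n ∸ i) % 3) % 3      ≡⟨ ≡.cong₂ (λ u v → (u ℕ.+ v) % 3) i≡r n∸i≡s ⟩
      (r ℕ.+ s) % 3                    ∎))
      where open ≡.≡-Reasoning

  Mod3Support-oneₚ : Mod3Support 0 oneₚ
  Mod3Support-oneₚ zero    0≢0 = ⊥-elim (0≢0 ≡.refl)
  Mod3Support-oneₚ (suc n) _   = refl

  Mod3Support-xₚ : Mod3Support 1 xₚ
  Mod3Support-xₚ zero          _   = refl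
  Mod3Support-xₚ (suc zero)    1≢1 = ⊥-elim (1≢1 ≡.refl)
  Mod3Support-xₚ (suc (suc n)) _   = refl

  Mod3Support-powₚ : ∀ {h} → Mod3Support 1 h → ∀ k → Mod3Support (k % 3) (powₚ h k)
  Mod3Support-powₚ supp zero    = Mod3Support-oneₚ
  Mod3Support-powₚ {h} supp (suc k) =
    ≡.subst (λ r → Mod3Support r (powₚ h (suc k))) (≡.sym (%-distribˡ-+ 1 k 3))
            (Mod3Support-·ₚ supp (Mod3Support-powₚ supp k))

  Mod3Support-powₚ-0 : ∀ {w} → Mod3Support 0 w → ∀ k → Mod3Support 0 (powₚ w k)
  Mod3Support-powₚ-0 supp zero    = Mod3Support-oneₚ
  Mod3Support-powₚ-0 supp (suc k) = Mod3Support-·ₚ supp (Mod3Support-powₚ-0 supp k)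

  Mod3Support-∘ₚ : ∀ {r G h} → Mod3Support r G → Mod3Support 1 h → Mod3Support r (G ∘ₚ h)
  Mod3Support-∘ₚ {r} {G} {h} suppG supph n n≢r = sumTo-≈0 n term
    where
    term : ∀ k → k ℕ.≤ n → G k * powₚ h k n ≈ 0#
    term k _ with k % 3 ℕ.≟ r
    ... | no k≢r  = trans (*-congʳ (suppG k k≢r)) (zeroˡ _)
    ... | yes k≡r = trans (*-congˡ (Mod3Support-powₚ supph k n (λ n≡k → n≢r (≡.trans n≡k k≡r)))) (zeroʳ _)

  Mod3Support-∘ₚ-0 : ∀ G {w} → Mod3Support 0 w → Mod3Support 0 (G ∘ₚ w)
  Mod3Support-∘ₚ-0 G supp n n≢0 = sumTo-≈0 n (λ k _ → trans (*-congˡ (Mod3Support-powₚ-0 supp k n n≢0)) (zeroʳ _))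

  Mod3Support-dropConst : ∀ {a} → Mod3Support 0 a → Mod3Support 0 (dropConst a)
  Mod3Support-dropConst supp zero    _   = refl
  Mod3Support-dropConst supp (suc n) n≢0 = supp (suc n) n≢0

  Mod3Support-divX : ∀ {a} → Mod3Support 1 a → Mod3Support 0 (divX a)
  Mod3Support-divX supp n n≢0 = supp (suc n) (λ 1+n≡1 → n≢0 ([1+n]%3≡1⇒n%3≡0 n 1+n≡1))

  Mod3Support-mulX : ∀ {a} → Mod3Support 0 a → Mod3Support 1 (mulX a)
  Mod3Support-mulX supp zero    _     = refl
  Mod3Support-mulX supp (suc n) 1+n≢1 = supp n (λ n≡0 → 1+n≢1 (n%3≡0⇒[1+n]%3≡1 n n≡0))

  Mod3Support-divX³ : ∀ {a} → Mod3Support 0 a → Mod3Support 0 (divX³ a)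
  Mod3Support-divX³ supp n = supp (3 ℕ.+ n)

  Mod3Support-invₚ : ∀ {v} → Mod3Support 0 v → Mod3Support 0 (invₚ v)
  Mod3Support-invₚ supp = Mod3Support-∘ₚ-0 altSigns (Mod3Support-dropConst supp)

  Mod3Support-revert : ∀ {h} → Mod3Support 1 h → Mod3Support 1 (revert h)
  Mod3Support-revert {h} supp n = below n n ℕₚ.≤-refl
    where
    below : ∀ n k → k ℕ.≤ n → k % 3 ≢ 1 → revert h k ≈ 0#
    below n zero _ _ = refl
    below (suc n) (suc k) k≤1+n k≢1 with ℕₚ.m≤n⇒m<n∨m≡n k≤1+n
    ... | inj₁ (s≤s k<n) = below n (suc k) k<n k≢1
    ... | inj₂ ≡.refl    = trans (revert-suc h k) (trans (+-cong (Mod3Support-xₚ (suc k) k≢1) (-‿cong (sumTo-≈0 k term)))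
                                                         (trans (+-congˡ -0#≈0#) 0+0≈0))
      where
      term : ∀ j → j ℕ.≤ k → revert h j * powₚ h j (suc k) ≈ 0#
      term j j≤k with j % 3 ℕ.≟ 1
      ... | no j≢1  = trans (*-congʳ (below k j j≤k j≢1)) (zeroˡ _)
      ... | yes j≡1 = trans (*-congˡ (Mod3Support-powₚ supp j (suc k) (λ 1+k≡j → k≢1 (≡.trans 1+k≡j j≡1)))) (zeroʳ _)

module CubeRoots {c ℓ} (R : CommutativeRing c ℓ) (ι : ℚ → CommutativeRing.Carrier R)
                 (ι-mono : ContainsℚVia R ι) where
  open CommutativeRing R hiding (zero)
  open TripleRiordan R ι
  open PowerSeries R ι
  open RingProperties ring using (-‿distribʳ-*; +-cancelˡ; +-identityˡ-unique)
  open CommutativeSemigroupProperties +-commutativeSemigroup using (xy∙z≈xz∙y) renaming (interchange to +-interchange)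
  open CommutativeSemigroupProperties *-commutativeSemigroup using (x∙yz≈y∙xz)
  private
    module ιₕ = RingMorphisms.IsRingMonomorphism ι-mono

  fromℕ : ℕ → Carrier
  fromℕ n = ι (+ n / 1)

  fromℕ-zero : fromℕ 0 ≈ 0#
  fromℕ-zero = ιₕ.0#-homo

  fromℕ-suc : ∀ n → fromℕ (suc n) ≈ fromℕ n + 1#
  fromℕ-suc n = trans (reflexive (≡.cong ι ([1+n]/1≡n/1+1 n))) (trans (ιₕ.+-homo _ _) (+-congˡ ιₕ.1#-homo))

  fromℕ-one : fromℕ 1 ≈ 1#
  fromℕ-one = trans (fromℕ-suc 0) (trans (+-congʳ fromℕ-zero) (+-identityˡ 1#))

  fromℕ-+ : ∀ i j → fromℕ (i ℕ.+ j) ≈ fromℕ i + fromℕ j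
  fromℕ-+ zero    j = sym (trans (+-congʳ fromℕ-zero) (+-identityˡ _))
  fromℕ-+ (suc i) j = begin
    fromℕ (suc (i ℕ.+ j))       ≈⟨ fromℕ-suc (i ℕ.+ j) ⟩
    fromℕ (i ℕ.+ j) + 1#        ≈⟨ +-congʳ (fromℕ-+ i j) ⟩
    (fromℕ i + fromℕ j) + 1#    ≈⟨ xy∙z≈xz∙y _ _ _ ⟩
    (fromℕ i + 1#) + fromℕ j    ≈⟨ +-congʳ (fromℕ-suc i) ⟨
    fromℕ (suc i) + fromℕ j     ∎
    where open SetoidReasoning setoid

  fromℕ-suc-invertible : ∀ n → fromℕ (suc n) * ι (+ 1 / suc n) ≈ 1#
  fromℕ-suc-invertible n = trans (sym (ιₕ.*-homo _ _)) (trans (reflexive (≡.cong ι ([1+n]/1*1/[1+n]≡1 n))) ιₕ.1#-homo)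

  fromℕ-suc-cancel : ∀ n {y} → fromℕ (suc n) * y ≈ 0# → y ≈ 0#
  fromℕ-suc-cancel n {y} [1+n]y≈0 = begin
    y                                         ≈⟨ *-identityˡ y ⟨
    1# * y                                    ≈⟨ *-congʳ (trans (*-comm _ _) (fromℕ-suc-invertible n)) ⟨
    (ι (+ 1 / suc n) * fromℕ (suc n)) * y     ≈⟨ *-assoc _ _ _ ⟩
    ι (+ 1 / suc n) * (fromℕ (suc n) * y)     ≈⟨ *-congˡ [1+n]y≈0 ⟩
    ι (+ 1 / suc n) * 0#                      ≈⟨ zeroʳ _ ⟩
    0#                                        ∎
    where open SetoidReasoning setoid

  third : Carrier
  third = ι (+ 1 / 3)

  three-thirds : third + (third + third) ≈ 1#
  three-thirds = trans (sym (trans (ιₕ.+-homo _ _) (+-congˡ (ιₕ.+-homo _ _))))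
                       (trans (reflexive (≡.cong ι 1/3+1/3+1/3≡1)) ιₕ.1#-homo)

  β : PS
  β k = ι (binomThird k)

  β-zero : β 0 ≈ 1#
  β-zero = ιₕ.1#-homo

  β-suc : ∀ k → β (suc k) ≈ (β k * (third - fromℕ k)) * ι (+ 1 / suc k)
  β-suc k = trans (ιₕ.*-homo _ _) (*-congʳ (trans (ιₕ.*-homo _ _) (*-congˡ (trans (ιₕ.+-homo _ _) (+-congˡ (ιₕ.-‿homo _))))))

  θ : PS → PS
  θ a n = fromℕ n * a n

  θ-·ₚ : ∀ a b → θ (a ·ₚ b) ≈ₚ ((θ a ·ₚ b) +ₚ (a ·ₚ θ b))
  θ-·ₚ a b n = trans (*-distribˡ-sumTo n _ _) (trans (sumTo-cong≤ n leibniz) (sumTo-+ n _ _))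
    where
    open SetoidReasoning setoid
    leibniz : ∀ i → i ℕ.≤ n →
              fromℕ n * (a i * b (n ∸ i)) ≈ (fromℕ i * a i) * b (n ∸ i) + a i * (fromℕ (n ∸ i) * b (n ∸ i))
    leibniz i i≤n = begin
      fromℕ n * (a i * b (n ∸ i))                                     ≈⟨ *-congʳ (reflexive (≡.cong fromℕ (ℕₚ.m+[n∸m]≡n i≤n))) ⟨
      fromℕ (i ℕ.+ (n ∸ i)) * (a i * b (n ∸ i))                       ≈⟨ *-congʳ (fromℕ-+ i (n ∸ i)) ⟩
      (fromℕ i + fromℕ (n ∸ i)) * (a i * b (n ∸ i))                   ≈⟨ distribʳ _ _ _ ⟩
      fromℕ i * (a i * b (n ∸ i)) + fromℕ (n ∸ i) * (a i * b (n ∸ i)) ≈⟨ +-cong (sym (*-assoc _ _ _)) (x∙yz≈y∙xz _ _ _) ⟩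
      (fromℕ i * a i) * b (n ∸ i) + a i * (fromℕ (n ∸ i) * b (n ∸ i)) ∎

  -- (1 + x) θa = α x a is the differential equation (1 + x) a′ = α a of (1 + x)^α.
  BinomialODE : Carrier → PS → Set ℓ
  BinomialODE α a = (θ a +ₚ mulX (θ a)) ≈ₚ scal α (mulX a)

  BinomialODE-·ₚ : ∀ {α γ a b} → BinomialODE α a → BinomialODE γ b → BinomialODE (α + γ) (a ·ₚ b)
  BinomialODE-·ₚ {α} {γ} {a} {b} ode-a ode-b = begin
    θ (a ·ₚ b) +ₚ mulX (θ (a ·ₚ b))
      ≈⟨ +ₚ-cong (θ-·ₚ a b) (≈ₚ-trans (mulX-cong (θ-·ₚ a b)) (mulX-+ₚ (θ a ·ₚ b) (a ·ₚ θ b))) ⟩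
    ((θ a ·ₚ b) +ₚ (a ·ₚ θ b)) +ₚ (mulX (θ a ·ₚ b) +ₚ mulX (a ·ₚ θ b))
      ≈⟨ (λ n → +-interchange _ _ _ _) ⟩
    ((θ a ·ₚ b) +ₚ mulX (θ a ·ₚ b)) +ₚ ((a ·ₚ θ b) +ₚ mulX (a ·ₚ θ b))
      ≈⟨ +ₚ-cong (+ₚ-cong (≈ₚ-refl {θ a ·ₚ b}) (≈ₚ-sym (mulX-·ₚˡ (θ a) b)))
                 (+ₚ-cong (≈ₚ-refl {a ·ₚ θ b}) (≈ₚ-sym (mulX-·ₚʳ a (θ b)))) ⟩
    ((θ a ·ₚ b) +ₚ (mulX (θ a) ·ₚ b)) +ₚ ((a ·ₚ θ b) +ₚ (a ·ₚ mulX (θ b)))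
      ≈⟨ +ₚ-cong (≈ₚ-sym (·ₚ-distribʳ b (θ a) (mulX (θ a)))) (≈ₚ-sym (·ₚ-distribˡ a (θ b) (mulX (θ b)))) ⟩
    ((θ a +ₚ mulX (θ a)) ·ₚ b) +ₚ (a ·ₚ (θ b +ₚ mulX (θ b)))
      ≈⟨ +ₚ-cong (·ₚ-congʳ b ode-a) (·ₚ-congˡ a ode-b) ⟩
    (scal α (mulX a) ·ₚ b) +ₚ (a ·ₚ scal γ (mulX b))
      ≈⟨ +ₚ-cong (≈ₚ-sym (scal-·ₚˡ α (mulX a) b)) (≈ₚ-sym (scal-·ₚʳ γ a (mulX b))) ⟩
    scal α (mulX a ·ₚ b) +ₚ scal γ (a ·ₚ mulX b)
      ≈⟨ +ₚ-cong (λ n → *-congˡ (mulX-·ₚˡ a b n)) (λ n → *-congˡ (mulX-·ₚʳ a b n)) ⟩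
    scal α (mulX (a ·ₚ b)) +ₚ scal γ (mulX (a ·ₚ b))
      ≈⟨ (λ n → sym (distribʳ _ _ _)) ⟩
    scal (α + γ) (mulX (a ·ₚ b)) ∎
    where open ≈ₚ-Reasoning

  BinomialODE-β : BinomialODE third β
  BinomialODE-β zero    = trans (+-identityʳ _) (trans (*-congʳ fromℕ-zero) (trans (zeroˡ _) (sym (zeroʳ _))))
  BinomialODE-β (suc k) = begin
    fromℕ (suc k) * β (suc k) + fromℕ k * β k
      ≈⟨ +-congʳ (*-congˡ (β-suc k)) ⟩
    fromℕ (suc k) * ((β k * (third - fromℕ k)) * ι (+ 1 / suc k)) + fromℕ k * β k
      ≈⟨ +-congʳ (trans (x∙yz≈y∙xz _ _ _) (trans (*-congˡ (fromℕ-suc-invertible k)) (*-identityʳ _))) ⟩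
    β k * (third - fromℕ k) + fromℕ k * β k
      ≈⟨ +-congʳ (trans (distribˡ _ _ _) (+-congˡ (sym (-‿distribʳ-* _ _)))) ⟩
    (β k * third - β k * fromℕ k) + fromℕ k * β k
      ≈⟨ +-assoc _ _ _ ⟩
    β k * third + (- (β k * fromℕ k) + fromℕ k * β k)
      ≈⟨ +-congˡ (trans (+-congˡ (*-comm _ _)) (-‿inverseˡ _)) ⟩
    β k * third + 0#
      ≈⟨ trans (+-identityʳ _) (*-comm _ _) ⟩
    third * β k ∎
    where open SetoidReasoning setoid

  BinomialODE-unique : ∀ Y → BinomialODE 1# Y → Y 0 ≈ 1# → Y ≈ₚ (oneₚ +ₚ xₚ)
  BinomialODE-unique Y ode Y₀≈1 = coefficients
    where
    recurrence : ∀ n → fromℕ (suc n) * Y (suc n) + fromℕ n * Y n ≈ Y n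
    recurrence n = trans (ode (suc n)) (*-identityˡ _)
    Y₁≈1 : Y 1 ≈ 1#
    Y₁≈1 = begin
      Y 1                                  ≈⟨ trans (*-congʳ fromℕ-one) (*-identityˡ _) ⟨
      fromℕ 1 * Y 1                        ≈⟨ +-identityʳ _ ⟨
      fromℕ 1 * Y 1 + 0#                   ≈⟨ +-congˡ (trans (*-congʳ fromℕ-zero) (zeroˡ _)) ⟨
      fromℕ 1 * Y 1 + fromℕ 0 * Y 0        ≈⟨ recurrence 0 ⟩
      Y 0                                  ≈⟨ Y₀≈1 ⟩
      1#                                   ∎
      where open SetoidReasoning setoid
    Y₂₊≈0 : ∀ k → Y (suc (suc k)) ≈ 0#
    Y₂₊≈0 zero    = fromℕ-suc-cancel 1 (+-identityˡ-unique _ (fromℕ 1 * Y 1)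
                      (trans (recurrence 1) (sym (trans (*-congʳ fromℕ-one) (*-identityˡ _)))))
    Y₂₊≈0 (suc k) = fromℕ-suc-cancel (suc (suc k))
                      (trans (sym (+-identityʳ _)) (trans (+-congˡ (sym (trans (*-congˡ (Y₂₊≈0 k)) (zeroʳ _))))
                             (trans (recurrence (suc (suc k))) (Y₂₊≈0 k))))
    coefficients : Y ≈ₚ (oneₚ +ₚ xₚ)
    coefficients zero          = trans Y₀≈1 (sym (+-identityʳ _))
    coefficients (suc zero)    = trans Y₁≈1 (sym (+-identityˡ _))
    coefficients (suc (suc k)) = trans (Y₂₊≈0 k) (sym (+-identityˡ 0#))

  cubeₚ : PS → PS
  cubeₚ a = a ·ₚ (a ·ₚ a)

  cubeₚ-oneₚ : cubeₚ oneₚ ≈ₚ oneₚ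
  cubeₚ-oneₚ = ≈ₚ-trans (·ₚ-identityˡ (oneₚ ·ₚ oneₚ)) (·ₚ-identityˡ oneₚ)

  cubeₚ-constant : ∀ a → a 0 ≈ 1# → cubeₚ a 0 ≈ 1#
  cubeₚ-constant a a₀≈1 = trans (*-cong a₀≈1 (*-cong a₀≈1 a₀≈1)) (trans (*-identityˡ _) (*-identityˡ 1#))

  β³≈1+x : cubeₚ β ≈ₚ (oneₚ +ₚ xₚ)
  β³≈1+x = BinomialODE-unique (cubeₚ β)
    (≈ₚ-trans (BinomialODE-·ₚ BinomialODE-β (BinomialODE-·ₚ BinomialODE-β BinomialODE-β)) (λ n → *-congʳ three-thirds))
    (cubeₚ-constant β β-zero)

  cbrtₚ-constant : ∀ u → cbrtₚ u 0 ≈ 1#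
  cbrtₚ-constant u = trans (*-identityʳ _) β-zero

  cbrtₚ-cong : ∀ {u v} → u ≈ₚ v → cbrtₚ u ≈ₚ cbrtₚ v
  cbrtₚ-cong u≈v = ∘ₚ-congʳ β (dropConst-cong u≈v)

  cubeₚ-cbrtₚ : ∀ u → u 0 ≈ 1# → cubeₚ (cbrtₚ u) ≈ₚ u
  cubeₚ-cbrtₚ u u₀≈1 = begin
    cubeₚ (β ∘ₚ w)              ≈⟨ ∘ₚ-·ₚ₃ {w} refl β β β ⟨
    cubeₚ β ∘ₚ w                ≈⟨ ∘ₚ-congˡ w β³≈1+x ⟩
    (oneₚ +ₚ xₚ) ∘ₚ w           ≈⟨ [1+x]∘ₚdropConst u u₀≈1 ⟨
    u                           ∎
    where
    open ≈ₚ-Reasoning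
    w = dropConst u

  -- a³ - b³ = (a - b)(a² + ab + b²), and the second factor has the unit 3 as constant term.
  cubeₚ-injective : ∀ {a b} → a 0 ≈ 1# → b 0 ≈ 1# → cubeₚ a ≈ₚ cubeₚ b → a ≈ₚ b
  cubeₚ-injective {a} {b} a₀≈1 b₀≈1 a³≈b³ = ·ₚ-cancelʳ Q third[Q₀]≈1 aQ≈bQ
    where
    open ℙ-Solver using (solve; _:+_; _:*_; _:=_)
    Q : PS
    Q = (a ·ₚ a +ₚ a ·ₚ b) +ₚ b ·ₚ b
    factorisation : (cubeₚ a +ₚ b ·ₚ Q) ≈ₚ (cubeₚ b +ₚ a ·ₚ Q)
    factorisation = solve 2 (λ a b → (a :* (a :* a)) :+ (b :* ((a :* a :+ a :* b) :+ b :* b))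
                                  := (b :* (b :* b)) :+ (a :* ((a :* a :+ a :* b) :+ b :* b))) (λ _ → refl) a b
    aQ≈bQ : (a ·ₚ Q) ≈ₚ (b ·ₚ Q)
    aQ≈bQ n = sym (+-cancelˡ (cubeₚ b n) _ _ (trans (+-congʳ (sym (a³≈b³ n))) (factorisation n)))
    Q₀≈3 : Q 0 ≈ 1# + (1# + 1#)
    Q₀≈3 = trans (+-cong (+-cong (one a₀≈1 a₀≈1) (one a₀≈1 b₀≈1)) (one b₀≈1 b₀≈1)) (+-assoc _ _ _)
      where
      one : ∀ {x y} → x ≈ 1# → y ≈ 1# → x * y ≈ 1#
      one x≈1 y≈1 = trans (*-cong x≈1 y≈1) (*-identityˡ 1#)
    third[Q₀]≈1 : third * Q 0 ≈ 1#
    third[Q₀]≈1 = begin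
      third * Q 0                         ≈⟨ *-congˡ Q₀≈3 ⟩
      third * (1# + (1# + 1#))            ≈⟨ trans (distribˡ _ _ _) (+-congˡ (distribˡ _ _ _)) ⟩
      third * 1# + (third * 1# + third * 1#) ≈⟨ +-cong (*-identityʳ _) (+-cong (*-identityʳ _) (*-identityʳ _)) ⟩
      third + (third + third)             ≈⟨ three-thirds ⟩
      1#                                  ∎
      where open SetoidReasoning setoid

  cbrtₚ-cubeₚ : ∀ w → w 0 ≈ 1# → cbrtₚ (cubeₚ w) ≈ₚ w
  cbrtₚ-cubeₚ w w₀≈1 = cubeₚ-injective (cbrtₚ-constant (cubeₚ w)) w₀≈1 (cubeₚ-cbrtₚ (cubeₚ w) (cubeₚ-constant w w₀≈1))

  cubeRootX-unique : ∀ {f₁ f₂ f₃} h → h 0 ≈ 0# → h 1 ≈ 1# → (f₁ ·ₚ (f₂ ·ₚ f₃)) ≈ₚ cubeₚ h → cubeRootX f₁ f₂ f₃ ≈ₚ h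
  cubeRootX-unique {f₁} {f₂} {f₃} h h₀≈0 h₁≈1 f₁f₂f₃≈h³ = begin
    mulX (cbrtₚ (divX³ (f₁ ·ₚ (f₂ ·ₚ f₃))))     ≈⟨ mulX-cong (cbrtₚ-cong (divX³-cong f₁f₂f₃≈h³)) ⟩
    mulX (cbrtₚ (divX³ (cubeₚ h)))              ≈⟨ mulX-cong (cbrtₚ-cong (divX³-·ₚ h h h h₀≈0 h₀≈0 h₀≈0)) ⟩
    mulX (cbrtₚ (cubeₚ (divX h)))               ≈⟨ mulX-cong (cbrtₚ-cubeₚ (divX h) h₁≈1) ⟩
    mulX (divX h)                               ≈⟨ mulX-divX h h₀≈0 ⟩
    h                                           ∎
    where open ≈ₚ-Reasoning

module TripleRiordanGroup {c ℓ} (R : CommutativeRing c ℓ) (ι : ℚ → CommutativeRing.Carrier R)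
                          (ι-mono : ContainsℚVia R ι) where
  open CommutativeRing R hiding (zero)
  open TripleRiordan R ι
  open PowerSeries R ι
  open CubeRoots R ι ι-mono

  IsF⇒constant≈0 : ∀ {f} → IsF f → f 0 ≈ 0#
  IsF⇒constant≈0 (_ , supp) = supp 0 (λ ())

  IsG-cong : ∀ {a b} → a ≈ₚ b → IsG a → IsG b
  IsG-cong a≈b (a₀≈1 , supp) = trans (sym (a≈b 0)) a₀≈1 , Mod3Support-cong a≈b supp

  IsF-cong : ∀ {a b} → a ≈ₚ b → IsF a → IsF b
  IsF-cong a≈b (a₁≈1 , supp) = trans (sym (a≈b 1)) a₁≈1 , Mod3Support-cong a≈b supp

  IsG-oneₚ : IsG oneₚ
  IsG-oneₚ = refl , Mod3Support-oneₚ

  IsF-xₚ : IsF xₚ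
  IsF-xₚ = refl , Mod3Support-xₚ

  IsF-cubeRootX : ∀ {f₁ f₂ f₃} → IsF f₁ → IsF f₂ → IsF f₃ → IsF (cubeRootX f₁ f₂ f₃)
  IsF-cubeRootX {f₁} {f₂} {f₃} (_ , supp₁) (_ , supp₂) (_ , supp₃) =
    cbrtₚ-constant (divX³ (f₁ ·ₚ (f₂ ·ₚ f₃))) ,
    Mod3Support-mulX (Mod3Support-∘ₚ-0 β (Mod3Support-dropConst (Mod3Support-divX³
      (Mod3Support-·ₚ supp₁ (Mod3Support-·ₚ supp₂ supp₃)))))

  IsG-·ₚ-∘ₚ : ∀ {g G h} → IsG g → IsG G → Mod3Support 1 h → IsG (g ·ₚ (G ∘ₚ h))
  IsG-·ₚ-∘ₚ (g₀≈1 , suppg) (G₀≈1 , suppG) supph =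
    trans (*-cong g₀≈1 (trans (*-identityʳ _) G₀≈1)) (*-identityˡ 1#) , Mod3Support-·ₚ suppg (Mod3Support-∘ₚ suppG supph)

  IsF-∘ₚ : ∀ {F k} → IsF F → IsF k → IsF (F ∘ₚ k)
  IsF-∘ₚ {F} {k} IsF-F@(F₁≈1 , suppF) IsF-k@(k₁≈1 , suppk) = linear , Mod3Support-∘ₚ suppF suppk
    where
    linear : (F ∘ₚ k) 1 ≈ 1#
    linear = trans (+-cong (trans (*-congʳ (IsF⇒constant≈0 IsF-F)) (zeroˡ _))
                           (*-cong F₁≈1 (powₚ-diagonal {k} (IsF⇒constant≈0 IsF-k) k₁≈1 1)))
                   (trans (+-identityˡ _) (*-identityˡ 1#))

  IsF-·ₚ : ∀ {q F} → q 0 ≈ 1# → Mod3Support 0 q → IsF F → IsF (q ·ₚ F)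
  IsF-·ₚ {q} {F} q₀≈1 suppq IsF-F@(F₁≈1 , suppF) = linear , Mod3Support-·ₚ suppq suppF
    where
    linear : (q ·ₚ F) 1 ≈ 1#
    linear = trans (+-cong (*-cong q₀≈1 F₁≈1) (trans (*-congˡ (IsF⇒constant≈0 IsF-F)) (zeroʳ _)))
                   (trans (+-identityʳ _) (*-identityˡ 1#))

  /ₓ-constant : ∀ {f} h → f 1 ≈ 1# → (f /ₓ h) 0 ≈ 1#
  /ₓ-constant h f₁≈1 = trans (*-cong f₁≈1 (invₚ-constant (divX h))) (*-identityˡ 1#)

  Mod3Support-/ₓ : ∀ {f h} → Mod3Support 1 f → Mod3Support 1 h → Mod3Support 0 (f /ₓ h)
  Mod3Support-/ₓ suppf supph = Mod3Support-·ₚ (Mod3Support-divX suppf) (Mod3Support-invₚ (Mod3Support-divX supph))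

  IsF-component : ∀ {f h F} → IsF f → IsF h → IsF F → IsF ((f /ₓ h) ·ₚ (F ∘ₚ h))
  IsF-component {f} {h} (f₁≈1 , suppf) IsF-h IsF-F =
    IsF-·ₚ (/ₓ-constant {f} h f₁≈1) (Mod3Support-/ₓ suppf (proj₂ IsF-h)) (IsF-∘ₚ IsF-F IsF-h)

  cubeRootX-cong : ∀ {f₁ f₂ f₃ f₁′ f₂′ f₃′} → f₁ ≈ₚ f₁′ → f₂ ≈ₚ f₂′ → f₃ ≈ₚ f₃′ →
                   cubeRootX f₁ f₂ f₃ ≈ₚ cubeRootX f₁′ f₂′ f₃′
  cubeRootX-cong f₁≈ f₂≈ f₃≈ = mulX-cong (cbrtₚ-cong (divX³-cong (·ₚ-cong f₁≈ (·ₚ-cong f₂≈ f₃≈))))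

  cubeRootX≈xₚ : ∀ {f₁ f₂ f₃} → f₁ ≈ₚ xₚ → f₂ ≈ₚ xₚ → f₃ ≈ₚ xₚ → cubeRootX f₁ f₂ f₃ ≈ₚ xₚ
  cubeRootX≈xₚ {f₁} {f₂} {f₃} f₁≈x f₂≈x f₃≈x =
    cubeRootX-unique {f₁} {f₂} {f₃} xₚ refl refl (·ₚ-cong f₁≈x (·ₚ-cong f₂≈x f₃≈x))

  component≈F : ∀ {f h} F → f ≈ₚ xₚ → h ≈ₚ xₚ → ((f /ₓ h) ·ₚ (F ∘ₚ h)) ≈ₚ F
  component≈F {f} {h} F f≈x h≈x = begin
    (f /ₓ h) ·ₚ (F ∘ₚ h)       ≈⟨ ·ₚ-cong (/ₓ-cong f≈x h≈x) (∘ₚ-congʳ F h≈x) ⟩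
    (xₚ /ₓ xₚ) ·ₚ (F ∘ₚ xₚ)     ≈⟨ ·ₚ-cong (·ₚ-cong divX-xₚ (≈ₚ-trans (invₚ-cong divX-xₚ) invₚ-oneₚ)) (∘ₚ-xₚ F) ⟩
    (oneₚ ·ₚ oneₚ) ·ₚ F         ≈⟨ ·ₚ-congʳ F (·ₚ-identityˡ oneₚ) ⟩
    oneₚ ·ₚ F                   ≈⟨ ·ₚ-identityˡ F ⟩
    F                           ∎
    where open ≈ₚ-Reasoning

  component≈f : ∀ f h {F} → f 0 ≈ 0# → h 0 ≈ 0# → h 1 ≈ 1# → F ≈ₚ xₚ → ((f /ₓ h) ·ₚ (F ∘ₚ h)) ≈ₚ f
  component≈f f h {F} f₀≈0 h₀≈0 h₁≈1 F≈x = begin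
    (f /ₓ h) ·ₚ (F ∘ₚ h)     ≈⟨ ·ₚ-congˡ (f /ₓ h) (≈ₚ-trans (∘ₚ-congˡ h F≈x) (xₚ-∘ₚ h₀≈0)) ⟩
    (f /ₓ h) ·ₚ h            ≈⟨ ·ₚ-comm (f /ₓ h) h ⟩
    h ·ₚ (f /ₓ h)            ≈⟨ h·ₚ[f/ₓh]≈f f h f₀≈0 h₀≈0 h₁≈1 ⟩
    f                        ∎
    where open ≈ₚ-Reasoning

  D⊙A-factorisation : ∀ g f₁ f₂ f₃ → (⟨ g , xₚ , xₚ , xₚ ⟩ ⊙ ⟨ oneₚ , f₁ , f₂ , f₃ ⟩) ≈T ⟨ g , f₁ , f₂ , f₃ ⟩
  D⊙A-factorisation g f₁ f₂ f₃ =
    ≈ₚ-trans (·ₚ-congˡ g (oneₚ-∘ₚ h)) (·ₚ-identityʳ g) ,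
    component≈F f₁ ≈ₚ-refl h≈x , component≈F f₂ ≈ₚ-refl h≈x , component≈F f₃ ≈ₚ-refl h≈x
    where
    h = cubeRootX xₚ xₚ xₚ
    h≈x = cubeRootX≈xₚ ≈ₚ-refl ≈ₚ-refl ≈ₚ-refl

  InTR-eT : InTR eT
  InTR-eT = IsG-oneₚ , IsF-xₚ , IsF-xₚ , IsF-xₚ

  InD-intro : ∀ {t} → IsG (g t) → f₁ t ≈ₚ xₚ → f₂ t ≈ₚ xₚ → f₃ t ≈ₚ xₚ → InD t
  InD-intro IsG-g f₁≈x f₂≈x f₃≈x =
    (IsG-g , IsF-cong (≈ₚ-sym f₁≈x) IsF-xₚ , IsF-cong (≈ₚ-sym f₂≈x) IsF-xₚ , IsF-cong (≈ₚ-sym f₃≈x) IsF-xₚ) ,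
    f₁≈x , f₂≈x , f₃≈x

  gPart≈oneₚ : ∀ {g G} h → g ≈ₚ oneₚ → G ≈ₚ oneₚ → (g ·ₚ (G ∘ₚ h)) ≈ₚ oneₚ
  gPart≈oneₚ h g≈1 G≈1 = ≈ₚ-trans (·ₚ-cong g≈1 (≈ₚ-trans (∘ₚ-congˡ h G≈1) (oneₚ-∘ₚ h))) (·ₚ-identityˡ oneₚ)

  D-isSubgroup : IsSubgroup InD
  D-isSubgroup = (λ _ → proj₁) , InD-intro IsG-oneₚ ≈ₚ-refl ≈ₚ-refl ≈ₚ-refl , closed , inverse
    where
    closed : ∀ s t → InD s → InD t → InD (s ⊙ t)
    closed s t ((IsG-s , _) , s₁≈x , s₂≈x , s₃≈x) ((IsG-t , _) , t₁≈x , t₂≈x , t₃≈x) =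
      InD-intro (IsG-·ₚ-∘ₚ IsG-s IsG-t (Mod3Support-cong (≈ₚ-sym h≈x) Mod3Support-xₚ))
                (≈ₚ-trans (component≈F (f₁ t) s₁≈x h≈x) t₁≈x)
                (≈ₚ-trans (component≈F (f₂ t) s₂≈x h≈x) t₂≈x)
                (≈ₚ-trans (component≈F (f₃ t) s₃≈x h≈x) t₃≈x)
      where h≈x = cubeRootX≈xₚ s₁≈x s₂≈x s₃≈x
    inverse : ∀ s → InD s → Σ T4 λ s′ → InD s′ × ((s ⊙ s′) ≈T eT) × ((s′ ⊙ s) ≈T eT)
    inverse s ((IsG-s@(g₀≈1 , suppg) , _) , s₁≈x , s₂≈x , s₃≈x) =
      ⟨ invₚ (g s) , xₚ , xₚ , xₚ ⟩ ,
      InD-intro (invₚ-constant (g s) , Mod3Support-invₚ suppg) ≈ₚ-refl ≈ₚ-refl ≈ₚ-refl ,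
      (≈ₚ-trans (·ₚ-congˡ (g s) (≈ₚ-trans (∘ₚ-congʳ (invₚ (g s)) h≈x) (∘ₚ-xₚ (invₚ (g s))))) (invₚ-inverseʳ (g s) g₀≈1) ,
       component≈F xₚ s₁≈x h≈x , component≈F xₚ s₂≈x h≈x , component≈F xₚ s₃≈x h≈x) ,
      (≈ₚ-trans (·ₚ-congˡ (invₚ (g s)) (≈ₚ-trans (∘ₚ-congʳ (g s) h′≈x) (∘ₚ-xₚ (g s)))) (invₚ-inverseˡ (g s) g₀≈1) ,
       ≈ₚ-trans (component≈F (f₁ s) ≈ₚ-refl h′≈x) s₁≈x ,
       ≈ₚ-trans (component≈F (f₂ s) ≈ₚ-refl h′≈x) s₂≈x ,
       ≈ₚ-trans (component≈F (f₃ s) ≈ₚ-refl h′≈x) s₃≈x)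
      where
      h≈x = cubeRootX≈xₚ s₁≈x s₂≈x s₃≈x
      h′≈x = cubeRootX≈xₚ ≈ₚ-refl ≈ₚ-refl ≈ₚ-refl

  -- The inverse of (1, f₁, f₂, f₃) is (1, F₁, F₂, F₃) with Fᵢ = (x / qᵢ) ∘ k, where qᵢ = fᵢ / h and k
  -- is the reversion of h.  Since q₁q₂q₃ = 1 we get F₁F₂F₃ = k³, so the inverse's cube root is k.
  module AffineInverse {f₁ f₂ f₃} (IsF-f₁ : IsF f₁) (IsF-f₂ : IsF f₂) (IsF-f₃ : IsF f₃) where
    h : PS
    h = cubeRootX f₁ f₂ f₃

    IsF-h : IsF h
    IsF-h = IsF-cubeRootX IsF-f₁ IsF-f₂ IsF-f₃

    k : PS
    k = revert h

    q : PS → PS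
    q f = f /ₓ h

    inverseComponent : PS → PS
    inverseComponent f = mulX (invₚ (q f)) ∘ₚ k

    IsF-inverseComponent : ∀ {f} → IsF f → IsF (inverseComponent f)
    IsF-inverseComponent {f} (_ , suppf) =
      IsF-∘ₚ (invₚ-constant (q f) , Mod3Support-mulX (Mod3Support-invₚ (Mod3Support-/ₓ suppf (proj₂ IsF-h))))
             (revert-linear h , Mod3Support-revert (proj₂ IsF-h))

    component-inverseʳ : ∀ {f} → IsF f → (q f ·ₚ (inverseComponent f ∘ₚ h)) ≈ₚ xₚ
    component-inverseʳ {f} (f₁≈1 , _) = begin
      q f ·ₚ ((M ∘ₚ k) ∘ₚ h)       ≈⟨ ·ₚ-congˡ (q f) (∘ₚ-assoc {k} {h} refl refl M) ⟩
      q f ·ₚ (M ∘ₚ (k ∘ₚ h))       ≈⟨ ·ₚ-congˡ (q f) (∘ₚ-congʳ M (revert-∘ₚ h refl (proj₁ IsF-h))) ⟩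
      q f ·ₚ (M ∘ₚ xₚ)             ≈⟨ ·ₚ-congˡ (q f) (∘ₚ-xₚ M) ⟩
      q f ·ₚ mulX (invₚ (q f))     ≈⟨ mulX-·ₚʳ (q f) (invₚ (q f)) ⟩
      mulX (q f ·ₚ invₚ (q f))     ≈⟨ mulX-cong (invₚ-inverseʳ (q f) (/ₓ-constant {f} h f₁≈1)) ⟩
      mulX oneₚ                    ≈⟨ xₚ≈mulX-oneₚ ⟨
      xₚ                           ∎
      where
      open ≈ₚ-Reasoning
      M = mulX (invₚ (q f))

    Π-q≈oneₚ : (q f₁ ·ₚ (q f₂ ·ₚ q f₃)) ≈ₚ oneₚ
    Π-q≈oneₚ = begin
      (d₁ ·ₚ v⁻¹) ·ₚ ((d₂ ·ₚ v⁻¹) ·ₚ (d₃ ·ₚ v⁻¹))   ≈⟨ ·ₚ-interchange₃ d₁ d₂ d₃ v⁻¹ v⁻¹ v⁻¹ ⟩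
      (d₁ ·ₚ (d₂ ·ₚ d₃)) ·ₚ cubeₚ v⁻¹               ≈⟨ ·ₚ-congʳ (cubeₚ v⁻¹) (divX³-·ₚ f₁ f₂ f₃ f₁₀≈0 f₂₀≈0 f₃₀≈0) ⟨
      u ·ₚ cubeₚ v⁻¹                               ≈⟨ ·ₚ-congʳ (cubeₚ v⁻¹) (cubeₚ-cbrtₚ u u₀≈1) ⟨
      cubeₚ v ·ₚ cubeₚ v⁻¹                         ≈⟨ ·ₚ-interchange₃ v v v v⁻¹ v⁻¹ v⁻¹ ⟨
      cubeₚ (v ·ₚ v⁻¹)                             ≈⟨ ·ₚ-cong vv⁻¹≈1 (·ₚ-cong vv⁻¹≈1 vv⁻¹≈1) ⟩
      cubeₚ oneₚ                                   ≈⟨ cubeₚ-oneₚ ⟩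
      oneₚ                                         ∎
      where
      open ≈ₚ-Reasoning
      d₁ = divX f₁
      d₂ = divX f₂
      d₃ = divX f₃
      u = divX³ (f₁ ·ₚ (f₂ ·ₚ f₃))
      v = cbrtₚ u
      v⁻¹ = invₚ v
      f₁₀≈0 = IsF⇒constant≈0 IsF-f₁
      f₂₀≈0 = IsF⇒constant≈0 IsF-f₂
      f₃₀≈0 = IsF⇒constant≈0 IsF-f₃
      u₀≈1 : u 0 ≈ 1#
      u₀≈1 = trans (divX³-·ₚ f₁ f₂ f₃ f₁₀≈0 f₂₀≈0 f₃₀≈0 0)
                   (trans (*-cong (proj₁ IsF-f₁) (*-cong (proj₁ IsF-f₂) (proj₁ IsF-f₃)))
                          (trans (*-identityˡ _) (*-identityˡ 1#)))
      vv⁻¹≈1 : (v ·ₚ v⁻¹) ≈ₚ oneₚ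
      vv⁻¹≈1 = invₚ-inverseʳ v (cbrtₚ-constant u)

    Π-q⁻¹≈oneₚ : (invₚ (q f₁) ·ₚ (invₚ (q f₂) ·ₚ invₚ (q f₃))) ≈ₚ oneₚ
    Π-q⁻¹≈oneₚ = begin
      q₁⁻¹ ·ₚ (q₂⁻¹ ·ₚ q₃⁻¹)                                        ≈⟨ ·ₚ-identityʳ _ ⟨
      (q₁⁻¹ ·ₚ (q₂⁻¹ ·ₚ q₃⁻¹)) ·ₚ oneₚ                              ≈⟨ ·ₚ-congˡ (q₁⁻¹ ·ₚ (q₂⁻¹ ·ₚ q₃⁻¹)) Π-q≈oneₚ ⟨
      (q₁⁻¹ ·ₚ (q₂⁻¹ ·ₚ q₃⁻¹)) ·ₚ (q f₁ ·ₚ (q f₂ ·ₚ q f₃))          ≈⟨ ·ₚ-interchange₃ q₁⁻¹ q₂⁻¹ q₃⁻¹ (q f₁) (q f₂) (q f₃) ⟨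
      (q₁⁻¹ ·ₚ q f₁) ·ₚ ((q₂⁻¹ ·ₚ q f₂) ·ₚ (q₃⁻¹ ·ₚ q f₃))
        ≈⟨ ·ₚ-cong (cancel IsF-f₁) (·ₚ-cong (cancel IsF-f₂) (cancel IsF-f₃)) ⟩
      cubeₚ oneₚ                                                    ≈⟨ cubeₚ-oneₚ ⟩
      oneₚ                                                          ∎
      where
      open ≈ₚ-Reasoning
      q₁⁻¹ = invₚ (q f₁)
      q₂⁻¹ = invₚ (q f₂)
      q₃⁻¹ = invₚ (q f₃)
      cancel : ∀ {f} → IsF f → (invₚ (q f) ·ₚ q f) ≈ₚ oneₚ
      cancel {f} (f₁≈1 , _) = invₚ-inverseˡ (q f) (/ₓ-constant {f} h f₁≈1)

    inverseComponent≈k·ₚr : ∀ f → inverseComponent f ≈ₚ (k ·ₚ (invₚ (q f) ∘ₚ k))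
    inverseComponent≈k·ₚr f = mulX-∘ₚ {k} refl (invₚ (q f))

    Π-inverseComponent≈k³ : (inverseComponent f₁ ·ₚ (inverseComponent f₂ ·ₚ inverseComponent f₃)) ≈ₚ cubeₚ k
    Π-inverseComponent≈k³ = begin
      inverseComponent f₁ ·ₚ (inverseComponent f₂ ·ₚ inverseComponent f₃)
        ≈⟨ ·ₚ-cong (inverseComponent≈k·ₚr f₁) (·ₚ-cong (inverseComponent≈k·ₚr f₂) (inverseComponent≈k·ₚr f₃)) ⟩
      (k ·ₚ r₁) ·ₚ ((k ·ₚ r₂) ·ₚ (k ·ₚ r₃))     ≈⟨ ·ₚ-interchange₃ k k k r₁ r₂ r₃ ⟩
      cubeₚ k ·ₚ (r₁ ·ₚ (r₂ ·ₚ r₃))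
        ≈⟨ ·ₚ-congˡ (cubeₚ k) (∘ₚ-·ₚ₃ {k} refl (invₚ (q f₁)) (invₚ (q f₂)) (invₚ (q f₃))) ⟨
      cubeₚ k ·ₚ ((invₚ (q f₁) ·ₚ (invₚ (q f₂) ·ₚ invₚ (q f₃))) ∘ₚ k)
        ≈⟨ ·ₚ-congˡ (cubeₚ k) (≈ₚ-trans (∘ₚ-congˡ k Π-q⁻¹≈oneₚ) (oneₚ-∘ₚ k)) ⟩
      cubeₚ k ·ₚ oneₚ                           ≈⟨ ·ₚ-identityʳ (cubeₚ k) ⟩
      cubeₚ k                                   ∎
      where
      open ≈ₚ-Reasoning
      r₁ = invₚ (q f₁) ∘ₚ k
      r₂ = invₚ (q f₂) ∘ₚ k
      r₃ = invₚ (q f₃) ∘ₚ k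

    inverse-cubeRootX≈k : cubeRootX (inverseComponent f₁) (inverseComponent f₂) (inverseComponent f₃) ≈ₚ k
    inverse-cubeRootX≈k = cubeRootX-unique {inverseComponent f₁} {inverseComponent f₂} {inverseComponent f₃}
                            k refl (revert-linear h) Π-inverseComponent≈k³

    component-inverseˡ : ∀ {f} → IsF f →
      ((inverseComponent f /ₓ cubeRootX (inverseComponent f₁) (inverseComponent f₂) (inverseComponent f₃))
        ·ₚ (f ∘ₚ cubeRootX (inverseComponent f₁) (inverseComponent f₂) (inverseComponent f₃))) ≈ₚ xₚ
    component-inverseˡ {f} IsF-f@(f₁≈1 , _) = begin
      (inverseComponent f /ₓ H) ·ₚ (f ∘ₚ H)
        ≈⟨ ·ₚ-cong (/ₓ-cong (inverseComponent≈k·ₚr f) inverse-cubeRootX≈k) (∘ₚ-cong f≈h·ₚqf inverse-cubeRootX≈k) ⟩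
      ((k ·ₚ r) /ₓ k) ·ₚ ((h ·ₚ q f) ∘ₚ k)
        ≈⟨ ·ₚ-cong ([h·ₚr]/ₓh≈r k r refl (revert-linear h)) (∘ₚ-·ₚ {k} refl h (q f)) ⟩
      r ·ₚ ((h ∘ₚ k) ·ₚ (q f ∘ₚ k))             ≈⟨ ·ₚ-congˡ r (·ₚ-congʳ (q f ∘ₚ k) (∘ₚ-revert h refl (proj₁ IsF-h))) ⟩
      r ·ₚ (xₚ ·ₚ (q f ∘ₚ k))                   ≈⟨ ·ₚ.x∙yz≈y∙xz r xₚ (q f ∘ₚ k) ⟩
      xₚ ·ₚ (r ·ₚ (q f ∘ₚ k))                   ≈⟨ ·ₚ-congˡ xₚ (∘ₚ-·ₚ {k} refl (invₚ (q f)) (q f)) ⟨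
      xₚ ·ₚ ((invₚ (q f) ·ₚ q f) ∘ₚ k)          ≈⟨ ·ₚ-congˡ xₚ (∘ₚ-congˡ k (invₚ-inverseˡ (q f) (/ₓ-constant {f} h f₁≈1))) ⟩
      xₚ ·ₚ (oneₚ ∘ₚ k)                         ≈⟨ ·ₚ-congˡ xₚ (oneₚ-∘ₚ k) ⟩
      xₚ ·ₚ oneₚ                                ≈⟨ ·ₚ-identityʳ xₚ ⟩
      xₚ                                        ∎
      where
      open ≈ₚ-Reasoning
      H = cubeRootX (inverseComponent f₁) (inverseComponent f₂) (inverseComponent f₃)
      r = invₚ (q f) ∘ₚ k
      f≈h·ₚqf : f ≈ₚ (h ·ₚ q f)
      f≈h·ₚqf = ≈ₚ-sym (h·ₚ[f/ₓh]≈f f h (IsF⇒constant≈0 IsF-f) refl (proj₁ IsF-h))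

  A-isSubgroup : IsSubgroup InA
  A-isSubgroup = (λ _ → proj₁) , (InTR-eT , ≈ₚ-refl) , closed , inverse
    where
    closed : ∀ s t → InA s → InA t → InA (s ⊙ t)
    closed s t ((_ , IsF-s₁ , IsF-s₂ , IsF-s₃) , gs≈1) ((_ , IsF-t₁ , IsF-t₂ , IsF-t₃) , gt≈1) =
      (IsG-cong (≈ₚ-sym g≈1) IsG-oneₚ ,
       IsF-component IsF-s₁ IsF-h IsF-t₁ , IsF-component IsF-s₂ IsF-h IsF-t₂ , IsF-component IsF-s₃ IsF-h IsF-t₃) ,
      g≈1
      where
      IsF-h = IsF-cubeRootX IsF-s₁ IsF-s₂ IsF-s₃
      g≈1 = gPart≈oneₚ (cubeRootX (f₁ s) (f₂ s) (f₃ s)) gs≈1 gt≈1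
    inverse : ∀ s → InA s → Σ T4 λ s′ → InA s′ × ((s ⊙ s′) ≈T eT) × ((s′ ⊙ s) ≈T eT)
    inverse s ((_ , IsF-s₁ , IsF-s₂ , IsF-s₃) , gs≈1) =
      ⟨ oneₚ , inverseComponent (f₁ s) , inverseComponent (f₂ s) , inverseComponent (f₃ s) ⟩ ,
      ((IsG-oneₚ , IsF-inverseComponent IsF-s₁ , IsF-inverseComponent IsF-s₂ , IsF-inverseComponent IsF-s₃) , ≈ₚ-refl) ,
      (gPart≈oneₚ h gs≈1 ≈ₚ-refl ,
       component-inverseʳ IsF-s₁ , component-inverseʳ IsF-s₂ , component-inverseʳ IsF-s₃) ,
      (gPart≈oneₚ (cubeRootX (inverseComponent (f₁ s)) (inverseComponent (f₂ s)) (inverseComponent (f₃ s))) ≈ₚ-refl gs≈1 ,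
       component-inverseˡ IsF-s₁ , component-inverseˡ IsF-s₂ , component-inverseˡ IsF-s₃)
      where open AffineInverse IsF-s₁ IsF-s₂ IsF-s₃

  -- n ∈ 𝒟 contributes x to every component, so t ⊙ n has the components of t and the same cube
  -- root; hence (t ⊙ n) ⊙ t′ has the components of t ⊙ t′ ≈T eT.
  D-isNormal : IsNormal InD
  D-isNormal t n t′ (IsG-t , IsF-t₁ , IsF-t₂ , IsF-t₃) (IsG-t′ , _) ((IsG-n , _) , n₁≈x , n₂≈x , n₃≈x) (_ , e₁ , e₂ , e₃) _ =
    InD-intro (IsG-·ₚ-∘ₚ (IsG-·ₚ-∘ₚ IsG-t IsG-n supp-h) IsG-t′ (Mod3Support-cong (≈ₚ-sym h′≈h) supp-h))
              (≈ₚ-trans (·ₚ-cong (/ₓ-cong u₁ h′≈h) (∘ₚ-congʳ (f₁ t′) h′≈h)) e₁)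
              (≈ₚ-trans (·ₚ-cong (/ₓ-cong u₂ h′≈h) (∘ₚ-congʳ (f₂ t′) h′≈h)) e₂)
              (≈ₚ-trans (·ₚ-cong (/ₓ-cong u₃ h′≈h) (∘ₚ-congʳ (f₃ t′) h′≈h)) e₃)
    where
    h = cubeRootX (f₁ t) (f₂ t) (f₃ t)
    IsF-h = IsF-cubeRootX IsF-t₁ IsF-t₂ IsF-t₃
    supp-h = proj₂ IsF-h
    u₁ = component≈f (f₁ t) h (IsF⇒constant≈0 IsF-t₁) refl (proj₁ IsF-h) n₁≈x
    u₂ = component≈f (f₂ t) h (IsF⇒constant≈0 IsF-t₂) refl (proj₁ IsF-h) n₂≈x
    u₃ = component≈f (f₃ t) h (IsF⇒constant≈0 IsF-t₃) refl (proj₁ IsF-h) n₃≈x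
    h′≈h = cubeRootX-cong u₁ u₂ u₃

  ≈T-sym : ∀ {s t} → s ≈T t → t ≈T s
  ≈T-sym (g≈ , f₁≈ , f₂≈ , f₃≈) = ≈ₚ-sym g≈ , ≈ₚ-sym f₁≈ , ≈ₚ-sym f₂≈ , ≈ₚ-sym f₃≈

  TR≈D⋊A : IsSemidirectProduct InD InA
  TR≈D⋊A = D-isSubgroup , A-isSubgroup , D-isNormal , trivialIntersection , factorisation
    where
    trivialIntersection : ∀ t → InD t → InA t → t ≈T eT
    trivialIntersection t (_ , t₁≈x , t₂≈x , t₃≈x) (_ , g≈1) = g≈1 , t₁≈x , t₂≈x , t₃≈x
    factorisation : ∀ t → InTR t → Σ T4 λ n → Σ T4 λ a → InD n × InA a × (t ≈T (n ⊙ a))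
    factorisation t (IsG-t , IsF-t₁ , IsF-t₂ , IsF-t₃) =
      ⟨ g t , xₚ , xₚ , xₚ ⟩ , ⟨ oneₚ , f₁ t , f₂ t , f₃ t ⟩ ,
      InD-intro IsG-t ≈ₚ-refl ≈ₚ-refl ≈ₚ-refl , ((IsG-oneₚ , IsF-t₁ , IsF-t₂ , IsF-t₃) , ≈ₚ-refl) ,
      ≈T-sym (D⊙A-factorisation (g t) (f₁ t) (f₂ t) (f₃ t))

mainTheorem5 : ∀ {c ℓ : Level} (R : CommutativeRing c ℓ) (ι : ℚ → CommutativeRing.Carrier R)
    → ContainsℚVia R ι
    → let open TripleRiordan R ι in
      (∀ (g f₁ f₂ f₃ : PS) → InTR ⟨ g , f₁ , f₂ , f₃ ⟩
        → (⟨ g , xₚ , xₚ , xₚ ⟩ ⊙ ⟨ oneₚ , f₁ , f₂ , f₃ ⟩) ≈T ⟨ g , f₁ , f₂ , f₃ ⟩)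
      × IsSemidirectProduct InD InA
mainTheorem5 R ι ι-mono = (λ g f₁ f₂ f₃ _ → D⊙A-factorisation g f₁ f₂ f₃) , TR≈D⋊A
  where open TripleRiordanGroup R ι ι-mono
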